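{- Let $m\ge 2$ be an integer and $p\equiv 1\pmod m$ a prime. Then \[ \left(\left(\frac{p^2-1}{m}\right)_p!\right)^{p-1}\equiv 1\pmod{p^2}\iff \frac{1}{m}\left(w_p-H_{\frac{p-1}{m}}\right)-\sum_{a=1}^{\frac{p-1}{m}}q_p(a)\equiv 0\pmod p. \]
   Context: For positive integers $N,n$, the Gauss factorial is $N_n!=\prod_{1\le i\le N,\ \gcd(i,n)=1} i$. For $a$ coprime to $p$, $q_p(a)=(a^{p-1}-1)/p$ is the Fermat quotient; $w_p=((p-1)!+1)/p$ is the Wilson quotient; $H_n=\sum_{a=1}^n 1/a$ is the $n$-th harmonic number. The right-hand congruence is taken among rationals with denominators prime to $p$. -}

module Defs where

open import Data.Nat as ℕ using (ℕ; zero; suc; _∸_; _^_)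
open import Data.Nat.GCD using (gcd)
open import Data.Nat using (_!)
import Data.Nat.Divisibility as ND
open import Data.Product using (_×_)
import Data.Nat.DivMod as NDM
open import Data.Integer as ℤ using (ℤ; +_)
import Data.Integer.Divisibility as ℤD
open import Data.Rational as ℚ using (ℚ; ↥_; ↧ₙ_)
open import Relation.Nullary using (¬_; does)
open import Data.Bool using (if_then_else_)
open import Relation.Binary.PropositionalEquality using (_≡_)

-- Exact-division helpers with explicit handling of a zero divisor
-- (the divisor is never zero where they are used).
_/ₙ_ : ℕ → ℕ → ℕ
a /ₙ zero = 0
a /ₙ suc d = NDM._/_ a (suc d)

_/ℚ_ : ℤ → ℕ → ℚ
z /ℚ zero = ℚ.0ℚ
z /ℚ suc d = ℚ._/_ z (suc d)

gaussFact : ℕ → ℕ → ℕ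
gaussFact zero n = 1
gaussFact (suc N) n =
  (if does (gcd (suc N) n ℕ.≟ 1) then suc N else 1) ℕ.* gaussFact N n

infix 4 _≡_[modℕ_]
_≡_[modℕ_] : ℕ → ℕ → ℕ → Set
a ≡ b [modℕ n ] = (+ n) ℤD.∣ ((+ a) ℤ.- (+ b))

-- x ≡ 0 (mod p) for a rational x with denominator prime to p:
-- in lowest terms, p divides the numerator and not the denominator
infix 4 _≡0[modℚ_]
_≡0[modℚ_] : ℚ → ℕ → Set
x ≡0[modℚ p ] = ((+ p) ℤD.∣ (↥ x)) × (¬ (p ND.∣ (↧ₙ x)))

fermatQuotient : ℕ → ℕ → ℚ
fermatQuotient p a = ((+ (a ^ (p ∸ 1))) ℤ.- (+ 1)) /ℚ p

wilsonQuotient : ℕ → ℚ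
wilsonQuotient p = (+ ((p ∸ 1) ! ℕ.+ 1)) /ℚ p

sumFrom1 : ℕ → (ℕ → ℚ) → ℚ
sumFrom1 zero f = ℚ.0ℚ
sumFrom1 (suc n) f = sumFrom1 n f ℚ.+ f (suc n)

harmonic : ℕ → ℚ
harmonic n = sumFrom1 n (λ a → (+ 1) /ℚ a)

{-# OPTIONS --safe #-}
-- Write p − 1 = m·n, so that (p² − 1)/m = n·p + n.  Grouping 1, …, n·p + n into
-- blocks of p consecutive integers, a complete block c·p + 1, …, c·p + (p − 1)
-- contributes (p − 1)! + c·p·(p − 1)!·H_{p−1} ≡ (p − 1)! modulo p², since p divides
-- the numerator (p − 1)!·H_{p−1} for odd p; the last block contributes n! + n·p·n!·H_n.
-- Raising G = ((p − 1)!)^n (n! + n·p·n!·H_n) to the power p − 1 and expanding with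
-- Wilson, (p − 1)! = −1 + p·w_p, and Fermat, (n!)^{p−1} ≡ 1 + p·Σ_{a≤n} q_p(a),
-- gives m·n!·(G^{p−1} − 1) ≡ −p·m·n!·x (mod p²) for the rational x on the right.
-- As p ∤ m·n!, both sides of the equivalence say that p² divides p·m·n!·x.
module Submission where

open import Data.Bool using (if_then_else_)
open import Data.Empty using (⊥-elim)
open import Data.Integer as ℤ using (ℤ; +_; _+_; _*_; _-_; -_; _^_; -1ℤ)
import Data.Integer.Divisibility.Signed as ℤS
import Data.Integer.Properties as ℤP
open import Data.Integer.Tactic.RingSolver using (solve-∀)
open import Data.List as List using (List; []; _∷_; filter; applyDownFrom)
open import Data.List.Membership.Propositional using (_∈_)
open import Data.List.Membership.Propositional.Properties using (∈-filter⁺; ∈-filter⁻; ∈-applyDownFrom⁺; ∈-applyDownFrom⁻)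
open import Data.List.Properties using (filter-accept; filter-reject; filter-all; length-filter)
open import Data.List.Relation.Unary.All as All using (All)
open import Data.List.Relation.Unary.Any using (here; there)
open import Data.List.Relation.Unary.Unique.Propositional using (Unique; _∷_)
import Data.List.Relation.Unary.Unique.Propositional.Properties as Unique
open import Data.Nat as ℕ using (ℕ; zero; suc; _!; _∸_; z≤n; s≤s)
open import Data.Nat.Combinatorics using (_C_; nCk+nC[k+1]≡[n+1]C[k+1]; nCn≡1; k>n⇒nCk≡0; nCk≡n!/k![n-k]!; k![n∸k]!∣n!)
open import Data.Nat.Coprimality using (Coprime; coprime?)
open import Data.Nat.DivMod using (_%_; _/_; m≡m%n+[m/n]*n; m%n<n; m<n⇒m%n≡m; m/n*n≡m; m*n/n≡m)
open import Data.Nat.Divisibility as ℕD using (_∣_; divides)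
open import Data.Nat.GCD using (gcd; gcd[m,n]∣m; gcd[m,n]∣n; gcd-greatest)
open import Data.Nat.ListAction using (product)
open import Data.Nat.Primality using (Prime; ¬prime[0]; ¬prime[1]; euclidsLemma; prime⇒irreducible; prime⇒nonZero; prime⇒nonTrivial)
import Data.Nat.Properties as ℕP
import Data.Nat.Tactic.RingSolver as ℕ-Solver
open import Data.Product using (∃-syntax; _×_; _,_; proj₁; proj₂)
open import Data.Rational as ℚ using (ℚ; ↥_; ↧_; ↧ₙ_; toℚᵘ; fromℚᵘ)
import Data.Rational.Properties as ℚP
open import Data.Rational.Unnormalised as ℚᵘ using (ℚᵘ; mkℚᵘ; *≡*) renaming (↥_ to ↥ᵘ_; ↧_ to ↧ᵘ_)
open import Data.Sum using (_⊎_; inj₁; inj₂)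
open import Function.Bundles using (_⇔_; mk⇔; Equivalence)
import Function.Properties.Equivalence as ⇔
open import Relation.Binary.Bundles using (Setoid)
import Relation.Binary.Reasoning.Setoid as SetoidReasoning
open import Relation.Binary.PropositionalEquality
open import Relation.Nullary using (¬_; ¬?; contradiction; Dec; yes; no; does)
open import Relation.Nullary.Decidable using (recompute)

open import Defs

infix 4 _≡_[mod_]
infixr 4 _,_
record _≡_[mod_] (a b n : ℤ) : Set where
  constructor _,_
  field
    quotient : ℤ
    equation : a ≡ b + quotient * n

module _ {n : ℤ} where

  ≡mod-reflexive : ∀ {a b} → a ≡ b → a ≡ b [mod n ]
  ≡mod-reflexive {a} refl = + 0 , ring a n
    where ring : ∀ a n → a ≡ a + + 0 * n
          ring = solve-∀

  ≡mod-refl : ∀ {a} → a ≡ a [mod n ]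
  ≡mod-refl = ≡mod-reflexive refl

  ≡mod-sym : ∀ {a b} → a ≡ b [mod n ] → b ≡ a [mod n ]
  ≡mod-sym {b = b} (q , refl) = - q , ring b q n
    where ring : ∀ b q n → b ≡ b + q * n + - q * n
          ring = solve-∀

  ≡mod-trans : ∀ {a b c} → a ≡ b [mod n ] → b ≡ c [mod n ] → a ≡ c [mod n ]
  ≡mod-trans {c = c} (q , refl) (r , refl) = r + q , ring c q r n
    where ring : ∀ c q r n → c + r * n + q * n ≡ c + (r + q) * n
          ring = solve-∀

  ≡mod-+ : ∀ {a a′ b b′} → a ≡ a′ [mod n ] → b ≡ b′ [mod n ] → a + b ≡ a′ + b′ [mod n ]
  ≡mod-+ {a′ = a′} {b′ = b′} (q , refl) (r , refl) = q + r , ring a′ b′ q r n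
    where ring : ∀ a b q r n → a + q * n + (b + r * n) ≡ a + b + (q + r) * n
          ring = solve-∀

  ≡mod-neg : ∀ {a a′} → a ≡ a′ [mod n ] → - a ≡ - a′ [mod n ]
  ≡mod-neg {a′ = a′} (q , refl) = - q , ring a′ q n
    where ring : ∀ a q n → - (a + q * n) ≡ - a + - q * n
          ring = solve-∀

  ≡mod-- : ∀ {a a′ b b′} → a ≡ a′ [mod n ] → b ≡ b′ [mod n ] → a - b ≡ a′ - b′ [mod n ]
  ≡mod-- a≡a′ b≡b′ = ≡mod-+ a≡a′ (≡mod-neg b≡b′)

  ≡mod-* : ∀ {a a′ b b′} → a ≡ a′ [mod n ] → b ≡ b′ [mod n ] → a * b ≡ a′ * b′ [mod n ]
  ≡mod-* {a′ = a′} {b′ = b′} (q , refl) (r , refl) = q * b′ + a′ * r + q * r * n , ring a′ b′ q r n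
    where ring : ∀ a b q r n → (a + q * n) * (b + r * n) ≡ a * b + (q * b + a * r + q * r * n) * n
          ring = solve-∀

  ≡mod-^ : ∀ {a a′} k → a ≡ a′ [mod n ] → a ^ k ≡ a′ ^ k [mod n ]
  ≡mod-^ zero    _     = ≡mod-refl
  ≡mod-^ (suc k) a≡a′ = ≡mod-* a≡a′ (≡mod-^ k a≡a′)

  ≡mod-scaleˡ : ∀ c {a b} → a ≡ b [mod n ] → c * a ≡ c * b [mod c * n ]
  ≡mod-scaleˡ c {b = b} (q , refl) = q , ring c b q n
    where ring : ∀ c b q n → c * (b + q * n) ≡ c * b + q * (c * n)
          ring = solve-∀

  ≡mod-unscaleˡ : ∀ c {a b} .{{_ : ℤ.NonZero c}} → c * a ≡ c * b [mod c * n ] → a ≡ b [mod n ]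
  ≡mod-unscaleˡ c {a} {b} (q , eq) = q , ℤP.*-cancelˡ-≡ c a (b + q * n) (trans eq (ring c b q n))
    where ring : ∀ c b q n → c * b + q * (c * n) ≡ c * (b + q * n)
          ring = solve-∀

≡mod-setoid : ℤ → Setoid _ _
≡mod-setoid n = record
  { Carrier       = ℤ
  ; _≈_           = _≡_[mod n ]
  ; isEquivalence = record { refl = ≡mod-refl ; sym = ≡mod-sym ; trans = ≡mod-trans }
  }

module ≡mod-Reasoning (n : ℤ) = SetoidReasoning (≡mod-setoid n)

pos-∸ : ∀ {m n} → n ℕ.≤ m → + (m ∸ n) ≡ + m - + n
pos-∸ {m} {n} n≤m = sym (trans (ℤP.m-n≡m⊖n m n) (ℤP.⊖-≥ n≤m))

pos-^ : ∀ m k → + (m ℕ.^ k) ≡ (+ m) ^ k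
pos-^ m zero    = refl
pos-^ m (suc k) = trans (ℤP.pos-* m (m ℕ.^ k)) (cong (+ m *_) (pos-^ m k))

^-distribʳ-* : ∀ a b k → (a * b) ^ k ≡ a ^ k * b ^ k
^-distribʳ-* a b zero    = refl
^-distribʳ-* a b (suc k) = trans (cong (a * b *_) (^-distribʳ-* a b k)) (ring a b (a ^ k) (b ^ k))
  where ring : ∀ a b x y → a * b * (x * y) ≡ a * x * (b * y)
        ring = solve-∀

-1^[h+h]≡1 : ∀ h → -1ℤ ^ (h ℕ.+ h) ≡ + 1
-1^[h+h]≡1 zero    = refl
-1^[h+h]≡1 (suc h) rewrite ℕP.+-suc h h = trans (ring (-1ℤ ^ (h ℕ.+ h))) (-1^[h+h]≡1 h)
  where ring : ∀ x → -1ℤ * (-1ℤ * x) ≡ x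
        ring = solve-∀

≡mod0⇒∣ : ∀ {a n} → a ≡ + 0 [mod n ] → n ℤS.∣ a
≡mod0⇒∣ {a} {n} (q , eq) = ℤS.divides q (trans eq (ℤP.+-identityˡ (q * n)))

∣⇒≡mod0 : ∀ {a n} → n ℤS.∣ a → a ≡ + 0 [mod n ]
∣⇒≡mod0 {a} {n} (ℤS.divides q eq) = q , trans eq (sym (ℤP.+-identityˡ (q * n)))

pos-∣⇒≡mod0 : ∀ {m n} → n ∣ m → + m ≡ + 0 [mod + n ]
pos-∣⇒≡mod0 {n = n} (divides q refl) = ∣⇒≡mod0 (ℤS.divides (+ q) (ℤP.pos-* q n))

pos-≡mod0⇒∣ : ∀ {m n} → + m ≡ + 0 [mod + n ] → n ∣ m
pos-≡mod0⇒∣ m≡0 = ℤS.∣⇒∣ᵤ (≡mod0⇒∣ m≡0)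

a-b≡0⇒a≡b : ∀ {a b n} → a - b ≡ + 0 [mod n ] → a ≡ b [mod n ]
a-b≡0⇒a≡b {a} {b} {n} (q , eq) = q , trans (ring a b) (trans (cong (_+_ b) eq) (cong (_+_ b) (ℤP.+-identityˡ (q * n))))
  where ring : ∀ a b → a ≡ b + (a - b)
        ring = solve-∀

≡0[modp²]⇔p²∣ : ∀ p {X} → X ≡ + 0 [mod + p * + p ] ⇔ p ℕ.* p ∣ ℤ.∣ X ∣
≡0[modp²]⇔p²∣ p {X} = mk⇔
  (λ X≡0 → subst (_∣ ℤ.∣ X ∣) (ℤP.abs-* (+ p) (+ p)) (ℤS.∣⇒∣ᵤ (≡mod0⇒∣ X≡0)))
  (λ p²∣X → ∣⇒≡mod0 (ℤS.∣ᵤ⇒∣ (subst (_∣ ℤ.∣ X ∣) (sym (ℤP.abs-* (+ p) (+ p))) p²∣X)))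

pred≡-1 : ∀ n → + n ≡ -1ℤ [mod + suc n ]
pred≡-1 n = + 1 , sym (cong (_+_ -1ℤ) (ℤP.*-identityˡ (+ suc n)))

private
  ordered-residue-injective : ∀ {n a b} → a ℕ.≤ b → b ℕ.< n → + a ≡ + b [mod + n ] → a ≡ b
  ordered-residue-injective {n} {a} {b} a≤b b<n (q , eq) = ℕP.≤-antisym a≤b (ℕP.m∸n≡0⇒m≤n b-a≡0)
    where
    n∣b-a : n ∣ b ∸ a
    n∣b-a = ℤS.∣⇒∣ᵤ (ℤS.divides (- q) (trans (pos-∸ a≤b) (trans (cong (λ x → + b - x) eq) (ring (+ b) q (+ n)))))
      where ring : ∀ b q n → b - (b + q * n) ≡ - q * n
            ring = solve-∀
    b-a≡0 : b ∸ a ≡ 0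
    b-a≡0 = trans (sym (m<n⇒m%n≡m b-a<n)) (ℕD.n∣m⇒m%n≡0 (b ∸ a) n n∣b-a)
      where
      instance _ = ℕ.>-nonZero (ℕP.≤-<-trans z≤n b<n)
      b-a<n : b ∸ a ℕ.< n
      b-a<n = ℕP.≤-<-trans (ℕP.m∸n≤m b a) b<n

residue-injective : ∀ {n a b} → a ℕ.< n → b ℕ.< n → + a ≡ + b [mod + n ] → a ≡ b
residue-injective {a = a} {b} a<n b<n a≡b with ℕP.≤-total a b
... | inj₁ a≤b = ordered-residue-injective a≤b b<n a≡b
... | inj₂ b≤a = sym (ordered-residue-injective b≤a a<n (≡mod-sym a≡b))

inverse-unique : ∀ {n a b c} → a * b ≡ + 1 [mod n ] → a * c ≡ + 1 [mod n ] → b ≡ c [mod n ]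
inverse-unique {n} {a} {b} {c} ab≡1 ac≡1 = begin
  b                ≡⟨ ℤP.*-identityʳ b ⟨
  b * + 1          ≈⟨ ≡mod-* (≡mod-refl {a = b}) (≡mod-sym ac≡1) ⟩
  b * (a * c)      ≡⟨ ring a b c ⟩
  (a * b) * c      ≈⟨ ≡mod-* ab≡1 (≡mod-refl {a = c}) ⟩
  + 1 * c          ≡⟨ ℤP.*-identityˡ c ⟩
  c                ∎
  where
  open ≡mod-Reasoning n
  ring : ∀ a b c → b * (a * c) ≡ (a * b) * c
  ring = solve-∀

[u+Pv]^[1+k] : ∀ P u v k → (u + P * v) ^ suc k ≡ u ^ suc k + P * (+ suc k * u ^ k * v) [mod P * P ]
[u+Pv]^[1+k] P u v zero    = ≡mod-reflexive (ring u v P)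
  where ring : ∀ u v P → (u + P * v) * + 1 ≡ u * + 1 + P * (+ 1 * + 1 * v)
        ring = solve-∀
[u+Pv]^[1+k] P u v (suc k) = begin
  (u + P * v) * (u + P * v) ^ suc k                   ≈⟨ ≡mod-* (≡mod-refl {a = u + P * v}) ([u+Pv]^[1+k] P u v k) ⟩
  (u + P * v) * (u * uᵏ + P * (+ suc k * uᵏ * v))     ≈⟨ + suc k * uᵏ * v * v , ring u v P uᵏ (+ suc k) ⟩
  u * (u * uᵏ) + P * ((+ 1 + + suc k) * (u * uᵏ) * v) ∎
  where
  open ≡mod-Reasoning (P * P)
  uᵏ = u ^ k
  ring : ∀ u v P x K → (u + P * v) * (u * x + P * (K * x * v))
                        ≡ u * (u * x) + P * ((+ 1 + K) * (u * x) * v) + K * x * v * v * (P * P)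
  ring = solve-∀

[1+Pv]^k : ∀ P v k → (+ 1 + P * v) ^ k ≡ + 1 + P * (+ k * v) [mod P * P ]
[1+Pv]^k P v zero    = ≡mod-reflexive (ring P v)
  where ring : ∀ P v → + 1 ≡ + 1 + P * (+ 0 * v)
        ring = solve-∀
[1+Pv]^k P v (suc k) = begin
  (+ 1 + P * v) ^ suc k                               ≈⟨ [u+Pv]^[1+k] P (+ 1) v k ⟩
  (+ 1) ^ suc k + P * (+ suc k * (+ 1) ^ k * v)        ≡⟨ cong₂ (λ x y → x + P * (+ suc k * y * v)) (ℤP.^-zeroˡ (suc k)) (ℤP.^-zeroˡ k) ⟩
  + 1 + P * (+ suc k * + 1 * v)                        ≡⟨ cong (λ x → + 1 + P * (x * v)) (ℤP.*-identityʳ (+ suc k)) ⟩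
  + 1 + P * (+ suc k * v)                              ∎
  where open ≡mod-Reasoning (P * P)

[1+a][1+b]≡1+a+b : ∀ {n a b} → a ≡ + 0 [mod n ] → b ≡ + 0 [mod n ] → (+ 1 + a) * (+ 1 + b) ≡ + 1 + (a + b) [mod n * n ]
[1+a][1+b]≡1+a+b {n} (q , refl) (r , refl) = q * r , ring q r n
  where ring : ∀ q r n → (+ 1 + (+ 0 + q * n)) * (+ 1 + (+ 0 + r * n)) ≡ + 1 + (+ 0 + q * n + (+ 0 + r * n)) + q * r * (n * n)
        ring = solve-∀

K[K+PX]^[1+k] : ∀ P K X E k → K ^ suc k ≡ + 1 + E * P [mod P * P ] →
  K * (K + P * X) ^ suc k ≡ K + P * (E * K + + suc k * X) [mod P * P ]
K[K+PX]^[1+k] P K X E k Kᵖ≡1+EP = begin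
  K * (K + P * X) ^ suc k                         ≈⟨ ≡mod-* (≡mod-refl {a = K}) ([u+Pv]^[1+k] P K X k) ⟩
  K * (K ^ suc k + P * (+ suc k * K ^ k * X))     ≡⟨ ring₁ K (K ^ k) X P (+ suc k) ⟩
  K ^ suc k * (K + P * (+ suc k * X))             ≈⟨ ≡mod-* Kᵖ≡1+EP (≡mod-refl {a = K + P * (+ suc k * X)}) ⟩
  (+ 1 + E * P) * (K + P * (+ suc k * X))         ≈⟨ E * + suc k * X , ring₂ K X E P (+ suc k) ⟩
  K + P * (E * K + + suc k * X)                   ∎
  where
  open ≡mod-Reasoning (P * P)
  ring₁ : ∀ K Kᵏ X P s → K * (K * Kᵏ + P * (s * Kᵏ * X)) ≡ K * Kᵏ * (K + P * (s * X))
  ring₁ = solve-∀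
  ring₂ : ∀ K X E P s → (+ 1 + E * P) * (K + P * (s * X)) ≡ K + P * (E * K + s * X) + E * s * X * (P * P)
  ring₂ = solve-∀

module _ {p : ℕ} (prime : Prime p) where

  prime∤* : ∀ {a b} → ¬ p ∣ a → ¬ p ∣ b → ¬ p ∣ a ℕ.* b
  prime∤* {a} {b} p∤a p∤b p∣ab with euclidsLemma a b prime p∣ab
  ... | inj₁ p∣a = p∤a p∣a
  ... | inj₂ p∣b = p∤b p∣b

  prime∤! : ∀ {k} → k ℕ.< p → ¬ p ∣ k !
  prime∤! {zero}  _   p∣1 = ℕ.nonTrivial⇒≢1 {{prime⇒nonTrivial prime}} (ℕD.∣1⇒≡1 p∣1)
  prime∤! {suc k} k<p = prime∤* (ℕD.>⇒∤ k<p) (prime∤! (ℕP.<-trans (ℕP.n<1+n k) k<p))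

  prime-≡mod0-* : ∀ {a b} → a * b ≡ + 0 [mod + p ] → a ≡ + 0 [mod + p ] ⊎ b ≡ + 0 [mod + p ]
  prime-≡mod0-* {a} {b} ab≡0
    with euclidsLemma ℤ.∣ a ∣ ℤ.∣ b ∣ prime (subst (p ∣_) (ℤP.abs-* a b) (ℤS.∣⇒∣ᵤ (≡mod0⇒∣ ab≡0)))
  ... | inj₁ p∣a = inj₁ (∣⇒≡mod0 (ℤS.∣ᵤ⇒∣ p∣a))
  ... | inj₂ p∣b = inj₂ (∣⇒≡mod0 (ℤS.∣ᵤ⇒∣ p∣b))

  square≡1⇒≡±1 : ∀ {x} → x * x ≡ + 1 [mod + p ] → x ≡ + 1 [mod + p ] ⊎ x ≡ -1ℤ [mod + p ]
  square≡1⇒≡±1 {x} x²≡1 with prime-≡mod0-* [x-1][x+1]≡0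
    where
    [x-1][x+1]≡0 : (x - + 1) * (x - -1ℤ) ≡ + 0 [mod + p ]
    [x-1][x+1]≡0 = begin
      (x - + 1) * (x - -1ℤ)   ≡⟨ ring x ⟩
      x * x - + 1             ≈⟨ ≡mod-- x²≡1 (≡mod-refl {a = + 1}) ⟩
      + 1 - + 1               ≡⟨⟩
      + 0                     ∎
      where
      open ≡mod-Reasoning (+ p)
      ring : ∀ x → (x - + 1) * (x - -1ℤ) ≡ x * x - + 1
      ring = solve-∀
  ... | inj₁ x-1≡0 = inj₁ (a-b≡0⇒a≡b x-1≡0)
  ... | inj₂ x+1≡0 = inj₂ (a-b≡0⇒a≡b x+1≡0)

∤-multiple+small : ∀ {p} c {s} → 0 ℕ.< s → s ℕ.< p → ¬ p ∣ c ℕ.* p ℕ.+ s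
∤-multiple+small {p} c 0<s s<p p∣cp+s = ℕD.>⇒∤ {{ℕ.>-nonZero 0<s}} s<p (ℕD.∣m+n∣m⇒∣n p∣cp+s (ℕD.n∣m*n c))

-- Fermat's little theorem

Σ≤ : ℕ → (ℕ → ℕ) → ℕ
Σ≤ zero    f = f 0
Σ≤ (suc n) f = Σ≤ n f ℕ.+ f (suc n)

Σ≤-cong : ∀ n {f g : ℕ → ℕ} → (∀ k → f k ≡ g k) → Σ≤ n f ≡ Σ≤ n g
Σ≤-cong zero    f≗g = f≗g 0
Σ≤-cong (suc n) f≗g = cong₂ ℕ._+_ (Σ≤-cong n f≗g) (f≗g (suc n))

Σ≤-shift : ∀ n f → Σ≤ (suc n) f ≡ f 0 ℕ.+ Σ≤ n (λ k → f (suc k))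
Σ≤-shift zero    f = refl
Σ≤-shift (suc n) f = trans (cong (ℕ._+ f (suc (suc n))) (Σ≤-shift n f)) (ℕP.+-assoc (f 0) _ _)

Σ≤-+ : ∀ n f g → Σ≤ n (λ k → f k ℕ.+ g k) ≡ Σ≤ n f ℕ.+ Σ≤ n g
Σ≤-+ zero    f g = refl
Σ≤-+ (suc n) f g = trans (cong (ℕ._+ (f (suc n) ℕ.+ g (suc n))) (Σ≤-+ n f g))
                         (ring (Σ≤ n f) (Σ≤ n g) (f (suc n)) (g (suc n)))
  where ring : ∀ a b c d → a ℕ.+ b ℕ.+ (c ℕ.+ d) ≡ a ℕ.+ c ℕ.+ (b ℕ.+ d)
        ring = ℕ-Solver.solve-∀

*-distribˡ-Σ≤ : ∀ n x f → x ℕ.* Σ≤ n f ≡ Σ≤ n (λ k → x ℕ.* f k)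
*-distribˡ-Σ≤ zero    x f = refl
*-distribˡ-Σ≤ (suc n) x f = trans (ℕP.*-distribˡ-+ x (Σ≤ n f) (f (suc n)))
                                  (cong (ℕ._+ x ℕ.* f (suc n)) (*-distribˡ-Σ≤ n x f))

binomial-theorem : ∀ n x → (x ℕ.+ 1) ℕ.^ n ≡ Σ≤ n (λ k → (n C k) ℕ.* x ℕ.^ k)
binomial-theorem zero    x = refl
binomial-theorem (suc n) x = begin
  (x ℕ.+ 1) ℕ.* (x ℕ.+ 1) ℕ.^ n                 ≡⟨ cong ((x ℕ.+ 1) ℕ.*_) (binomial-theorem n x) ⟩
  (x ℕ.+ 1) ℕ.* Σ≤ n t                          ≡⟨ ring₁ x (Σ≤ n t) ⟩
  x ℕ.* Σ≤ n t ℕ.+ Σ≤ n t                        ≡⟨ cong₂ ℕ._+_ (*-distribˡ-Σ≤ n x t) (sym 1+Σu≡Σt) ⟩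
  Σ≤ n (λ k → x ℕ.* t k) ℕ.+ (1 ℕ.+ Σ≤ n u)      ≡⟨ ring₂ (Σ≤ n (λ k → x ℕ.* t k)) (Σ≤ n u) ⟩
  1 ℕ.+ (Σ≤ n (λ k → x ℕ.* t k) ℕ.+ Σ≤ n u)      ≡⟨ cong (1 ℕ.+_) (Σ≤-+ n (λ k → x ℕ.* t k) u) ⟨
  1 ℕ.+ Σ≤ n (λ k → x ℕ.* t k ℕ.+ u k)           ≡⟨ cong (1 ℕ.+_) (Σ≤-cong n pascal) ⟩
  1 ℕ.+ Σ≤ n (λ k → (suc n C suc k) ℕ.* x ℕ.^ suc k) ≡⟨ Σ≤-shift n (λ k → (suc n C k) ℕ.* x ℕ.^ k) ⟨
  Σ≤ (suc n) (λ k → (suc n C k) ℕ.* x ℕ.^ k)     ∎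
  where
  open ≡-Reasoning
  t u : ℕ → ℕ
  t k = (n C k) ℕ.* x ℕ.^ k
  u k = (n C suc k) ℕ.* x ℕ.^ suc k
  ring₁ : ∀ x s → (x ℕ.+ 1) ℕ.* s ≡ x ℕ.* s ℕ.+ s
  ring₁ = ℕ-Solver.solve-∀
  ring₂ : ∀ a b → a ℕ.+ (1 ℕ.+ b) ≡ 1 ℕ.+ (a ℕ.+ b)
  ring₂ = ℕ-Solver.solve-∀
  1+Σu≡Σt : 1 ℕ.+ Σ≤ n u ≡ Σ≤ n t
  1+Σu≡Σt = begin
    1 ℕ.+ Σ≤ n u                    ≡⟨ Σ≤-shift n t ⟨
    Σ≤ n t ℕ.+ t (suc n)            ≡⟨ cong (λ c → Σ≤ n t ℕ.+ c ℕ.* x ℕ.^ suc n) (k>n⇒nCk≡0 (ℕP.n<1+n n)) ⟩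
    Σ≤ n t ℕ.+ 0                    ≡⟨ ℕP.+-identityʳ (Σ≤ n t) ⟩
    Σ≤ n t                          ∎
  pascal : ∀ k → x ℕ.* t k ℕ.+ u k ≡ (suc n C suc k) ℕ.* x ℕ.^ suc k
  pascal k = trans (ring₃ (n C k) (n C suc k) x (x ℕ.^ k))
                   (cong (ℕ._* x ℕ.^ suc k) (nCk+nC[k+1]≡[n+1]C[k+1] n k))
    where ring₃ : ∀ a b x y → x ℕ.* (a ℕ.* y) ℕ.+ b ℕ.* (x ℕ.* y) ≡ (a ℕ.+ b) ℕ.* (x ℕ.* y)
          ring₃ = ℕ-Solver.solve-∀

module _ {p′ : ℕ} (prime : Prime (suc p′)) where

  private
    p = suc p′
    P = + p

  prime∣pCk : ∀ {k} → 0 ℕ.< k → k ℕ.< p → p ∣ p C k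
  prime∣pCk {k} 0<k k<p with euclidsLemma (p C k) (k ! ℕ.* (p ∸ k) !) prime p∣C·d
    where
    instance _ = ℕP._!*_!≢0 k (p ∸ k)
    p!≡C·d : p ! ≡ (p C k) ℕ.* (k ! ℕ.* (p ∸ k) !)
    p!≡C·d = sym (trans (cong (ℕ._* (k ! ℕ.* (p ∸ k) !)) (nCk≡n!/k![n-k]! (ℕP.<⇒≤ k<p)))
                        (m/n*n≡m (k![n∸k]!∣n! (ℕP.<⇒≤ k<p))))
    p∣C·d : p ∣ (p C k) ℕ.* (k ! ℕ.* (p ∸ k) !)
    p∣C·d = subst (p ∣_) p!≡C·d (ℕD.m∣m*n (p′ !))
  ... | inj₁ p∣C = p∣C
  ... | inj₂ p∣d = ⊥-elim (prime∤* prime (prime∤! prime k<p) (prime∤! prime (ℕP.∸-monoʳ-< 0<k (ℕP.<⇒≤ k<p))) p∣d)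

  binomial-prefix≡1 : ∀ x j → j ℕ.< p → + Σ≤ j (λ k → (p C k) ℕ.* x ℕ.^ k) ≡ + 1 [mod P ]
  binomial-prefix≡1 x zero    _     = ≡mod-refl
  binomial-prefix≡1 x (suc j) 1+j<p = begin
    + (Σ≤ j f ℕ.+ (p C suc j) ℕ.* x ℕ.^ suc j)       ≡⟨ ℤP.pos-+ (Σ≤ j f) _ ⟩
    + Σ≤ j f + + ((p C suc j) ℕ.* x ℕ.^ suc j)       ≡⟨ cong (_+_ (+ Σ≤ j f)) (ℤP.pos-* (p C suc j) _) ⟩
    + Σ≤ j f + + (p C suc j) * + (x ℕ.^ suc j)       ≈⟨ ≡mod-+ (binomial-prefix≡1 x j (ℕP.<-trans (ℕP.n<1+n j) 1+j<p))
                                                             (≡mod-* (pos-∣⇒≡mod0 (prime∣pCk (s≤s z≤n) 1+j<p)) ≡mod-refl) ⟩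
    + 1 + + 0 * + (x ℕ.^ suc j)                      ≡⟨ cong (_+_ (+ 1)) (ℤP.*-zeroˡ (+ (x ℕ.^ suc j))) ⟩
    + 1                                              ∎
    where
    open ≡mod-Reasoning P
    f : ℕ → ℕ
    f k = (p C k) ℕ.* x ℕ.^ k

  freshman′s-dream : ∀ x → + ((x ℕ.+ 1) ℕ.^ p) ≡ + 1 + + (x ℕ.^ p) [mod P ]
  freshman′s-dream x = begin
    + ((x ℕ.+ 1) ℕ.^ p)                               ≡⟨ cong +_ (binomial-theorem p x) ⟩
    + (Σ≤ p′ f ℕ.+ (p C p) ℕ.* x ℕ.^ p)               ≡⟨ cong (λ c → + (Σ≤ p′ f ℕ.+ c ℕ.* x ℕ.^ p)) (nCn≡1 p) ⟩
    + (Σ≤ p′ f ℕ.+ 1 ℕ.* x ℕ.^ p)                      ≡⟨ ℤP.pos-+ (Σ≤ p′ f) _ ⟩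
    + Σ≤ p′ f + + (1 ℕ.* x ℕ.^ p)                      ≈⟨ ≡mod-+ (binomial-prefix≡1 x p′ ℕP.≤-refl) (≡mod-reflexive (cong +_ (ℕP.*-identityˡ _))) ⟩
    + 1 + + (x ℕ.^ p)                                  ∎
    where
    open ≡mod-Reasoning P
    f : ℕ → ℕ
    f k = (p C k) ℕ.* x ℕ.^ k

  fermat-little : ∀ x → (+ x) ^ p ≡ + x [mod P ]
  fermat-little zero    = ≡mod-reflexive (ℤP.*-zeroˡ ((+ 0) ^ p′))
  fermat-little (suc x) = begin
    (+ suc x) ^ p              ≡⟨ pos-^ (suc x) p ⟨
    + (suc x ℕ.^ p)            ≡⟨ cong (λ y → + (y ℕ.^ p)) (ℕP.+-comm 1 x) ⟩
    + ((x ℕ.+ 1) ℕ.^ p)        ≈⟨ freshman′s-dream x ⟩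
    + 1 + + (x ℕ.^ p)          ≈⟨ ≡mod-+ (≡mod-refl {a = + 1}) (≡mod-trans (≡mod-reflexive (pos-^ x p)) (fermat-little x)) ⟩
    + 1 + + x                  ∎
    where open ≡mod-Reasoning P

  fermat : ∀ {a} → ¬ p ∣ a → (+ a) ^ p′ ≡ + 1 [mod P ]
  fermat {a} p∤a with prime-≡mod0-* prime a·[a^p′-1]≡0
    where
    a·[a^p′-1]≡0 : + a * ((+ a) ^ p′ - + 1) ≡ + 0 [mod P ]
    a·[a^p′-1]≡0 = begin
      + a * ((+ a) ^ p′ - + 1)     ≡⟨ ring (+ a) ((+ a) ^ p′) ⟩
      (+ a) ^ p - + a              ≈⟨ ≡mod-- (fermat-little a) (≡mod-refl {a = + a}) ⟩
      + a - + a                    ≡⟨ ℤP.+-inverseʳ (+ a) ⟩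
      + 0                          ∎
      where
      open ≡mod-Reasoning P
      ring : ∀ a b → a * (b - + 1) ≡ a * b - a
      ring = solve-∀
  ... | inj₁ a≡0       = ⊥-elim (p∤a (pos-≡mod0⇒∣ a≡0))
  ... | inj₂ a^p′-1≡0 = a-b≡0⇒a≡b a^p′-1≡0

-- Wilson's theorem

without : ℕ → List ℕ → List ℕ
without v = filter (λ y → ¬? (y ℕ.≟ v))

product-without : ∀ {v xs} → Unique xs → v ∈ xs → product xs ≡ v ℕ.* product (without v xs)
product-without {v} {v ∷ ys} (v∉ys ∷ _) (here refl) =
  cong (λ l → v ℕ.* product l) (sym (trans (filter-reject P? (λ v≢v → v≢v refl)) (filter-all P? (All.map ≢-sym v∉ys))))
  where P? = λ y → ¬? (y ℕ.≟ v)
product-without {v} {y ∷ ys} (y∉ys ∷ uniq) (there v∈ys) = begin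
  y ℕ.* product ys                         ≡⟨ cong (y ℕ.*_) (product-without uniq v∈ys) ⟩
  y ℕ.* (v ℕ.* product (without v ys))     ≡⟨ ring y v (product (without v ys)) ⟩
  v ℕ.* (y ℕ.* product (without v ys))     ≡⟨ cong (λ l → v ℕ.* product l) (filter-accept (λ z → ¬? (z ℕ.≟ v)) (All.lookup y∉ys v∈ys)) ⟨
  v ℕ.* product (without v (y ∷ ys))       ∎
  where
  open ≡-Reasoning
  ring : ∀ y v r → y ℕ.* (v ℕ.* r) ≡ v ℕ.* (y ℕ.* r)
  ring = ℕ-Solver.solve-∀

record InversePairing (n : ℤ) (σ : ℕ → ℕ) (xs : List ℕ) : Set where
  field
    closed      : ∀ {x} → x ∈ xs → σ x ∈ xs
    fixpointFree : ∀ {x} → x ∈ xs → σ x ≢ x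
    involutive  : ∀ {x} → x ∈ xs → σ (σ x) ≡ x
    inverse     : ∀ {x} → x ∈ xs → + x * + σ x ≡ + 1 [mod n ]

product-paired≡1 : ∀ {n σ} k {xs} → List.length xs ℕ.≤ k → Unique xs → InversePairing n σ xs →
                   + product xs ≡ + 1 [mod n ]
product-paired≡1             _       {[]}     _         _              _       = ≡mod-refl
product-paired≡1 {n} {σ} (suc k) {x ∷ ys} (s≤s len) (x∉ys ∷ uniq) pairing = begin
  + (x ℕ.* product ys)                     ≡⟨ cong (λ r → + (x ℕ.* r)) (product-without uniq σx∈ys) ⟩
  + (x ℕ.* (σ x ℕ.* product zs))           ≡⟨ trans (ℤP.pos-* x _) (trans (cong (+ x *_) (ℤP.pos-* (σ x) _)) (sym (ℤP.*-assoc (+ x) _ _))) ⟩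
  + x * + σ x * + product zs               ≈⟨ ≡mod-* (inverse (here refl)) (product-paired≡1 k len′ (Unique.filter⁺ P? uniq) pairing′) ⟩
  + 1 * + 1                                ∎
  where
  open ≡mod-Reasoning n
  open InversePairing pairing
  P? = λ y → ¬? (y ℕ.≟ σ x)
  zs = without (σ x) ys
  σx∈ys : σ x ∈ ys
  σx∈ys with closed (here refl)
  ... | here σx≡x = ⊥-elim (fixpointFree (here refl) σx≡x)
  ... | there σx∈ys = σx∈ys
  len′ : List.length zs ℕ.≤ k
  len′ = ℕP.≤-trans (length-filter P? ys) len
  zs⊆xs : ∀ {y} → y ∈ zs → y ∈ x ∷ ys
  zs⊆xs y∈zs = there (proj₁ (∈-filter⁻ P? y∈zs))
  closed′ : ∀ {y} → y ∈ zs → σ y ∈ zs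
  closed′ {y} y∈zs with ∈-filter⁻ P? y∈zs | closed (zs⊆xs y∈zs)
  ... | _ , y≢σx | here σy≡x = ⊥-elim (y≢σx (trans (sym (involutive (zs⊆xs y∈zs))) (cong σ σy≡x)))
  ... | y∈ys , _ | there σy∈ys = ∈-filter⁺ P? σy∈ys λ σy≡σx →
    All.lookup x∉ys y∈ys (trans (sym (involutive (here refl))) (trans (cong σ (sym σy≡σx)) (involutive (zs⊆xs y∈zs))))
  pairing′ : InversePairing n σ zs
  pairing′ = record
    { closed       = closed′
    ; fixpointFree = λ y∈zs → fixpointFree (zs⊆xs y∈zs)
    ; involutive   = λ y∈zs → involutive (zs⊆xs y∈zs)
    ; inverse      = λ y∈zs → inverse (zs⊆xs y∈zs)
    }

≢0∧≢1⇒≥2 : ∀ {y} → y ≢ 0 → y ≢ 1 → 2 ℕ.≤ y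
≢0∧≢1⇒≥2 {0}           y≢0 _   = ⊥-elim (y≢0 refl)
≢0∧≢1⇒≥2 {1}           _   y≢1 = ⊥-elim (y≢1 refl)
≢0∧≢1⇒≥2 {suc (suc _)} _   _   = s≤s (s≤s z≤n)

module _ {r : ℕ} (prime : Prime (3 ℕ.+ r)) where

  private
    p′ = 2 ℕ.+ r
    p  = suc p′
    P  = + p

  opaque
    inverse : ℕ → ℕ
    inverse x = x ℕ.^ suc r % p

    inverse<p : ∀ x → inverse x ℕ.< p
    inverse<p x = m%n<n (x ℕ.^ suc r) p

    inverse≡x^[p-2] : ∀ x → + inverse x ≡ (+ x) ^ suc r [mod P ]
    inverse≡x^[p-2] x = ≡mod-sym (+ (x ℕ.^ suc r / p) , x^[p-2]≡inverse+qp)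
      where
      open ≡-Reasoning
      x^[p-2]≡inverse+qp : (+ x) ^ suc r ≡ + inverse x + + (x ℕ.^ suc r / p) * P
      x^[p-2]≡inverse+qp = begin
        (+ x) ^ suc r                              ≡⟨ pos-^ x (suc r) ⟨
        + (x ℕ.^ suc r)                            ≡⟨ cong +_ (m≡m%n+[m/n]*n (x ℕ.^ suc r) p) ⟩
        + (inverse x ℕ.+ x ℕ.^ suc r / p ℕ.* p)    ≡⟨ ℤP.pos-+ (inverse x) _ ⟩
        + inverse x + + (x ℕ.^ suc r / p ℕ.* p)    ≡⟨ cong (_+_ (+ inverse x)) (ℤP.pos-* (x ℕ.^ suc r / p) p) ⟩
        + inverse x + + (x ℕ.^ suc r / p) * P      ∎

  *-inverse≡1 : ∀ {x} → ¬ p ∣ x → + x * + inverse x ≡ + 1 [mod P ]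
  *-inverse≡1 {x} p∤x = ≡mod-trans (≡mod-* (≡mod-refl {a = + x}) (inverse≡x^[p-2] x)) (fermat prime p∤x)

  -- 2 ≤ x ≤ p − 2: the residues that are not their own inverse
  Middle : ℕ → Set
  Middle x = 2 ℕ.≤ x × x ℕ.≤ suc r

  middleResidues : List ℕ
  middleResidues = applyDownFrom (2 ℕ.+_) r

  ∈middleResidues⇒Middle : ∀ {x} → x ∈ middleResidues → Middle x
  ∈middleResidues⇒Middle x∈ with ∈-applyDownFrom⁻ (2 ℕ.+_) x∈
  ... | i , i<r , refl = s≤s (s≤s z≤n) , s≤s i<r

  Middle⇒∈middleResidues : ∀ {x} → Middle x → x ∈ middleResidues
  Middle⇒∈middleResidues {suc (suc i)} (s≤s (s≤s z≤n) , s≤s i<r) = ∈-applyDownFrom⁺ (2 ℕ.+_) i<r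

  Middle⇒<p : ∀ {x} → Middle x → x ℕ.< p
  Middle⇒<p (_ , x≤1+r) = s≤s (ℕP.m≤n⇒m≤1+n x≤1+r)

  Middle⇒p∤ : ∀ {x} → Middle x → ¬ p ∣ x
  Middle⇒p∤ mx@(2≤x , _) = ℕD.>⇒∤ {{ℕ.>-nonZero (ℕP.<-≤-trans (s≤s z≤n) 2≤x)}} (Middle⇒<p mx)

  unique-middleResidues : Unique middleResidues
  unique-middleResidues = Unique.applyDownFrom⁺₁ (2 ℕ.+_) r
    (λ j<i _ 2+i≡2+j → ℕP.<⇒≢ j<i (sym (ℕP.+-cancelˡ-≡ 2 _ _ 2+i≡2+j)))

  product[2,1+k]≡[1+k]! : ∀ k → product (applyDownFrom (2 ℕ.+_) k) ≡ suc k !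
  product[2,1+k]≡[1+k]! zero    = refl
  product[2,1+k]≡[1+k]! (suc k) = cong (suc (suc k) ℕ.*_) (product[2,1+k]≡[1+k]! k)

  module _ {x : ℕ} (mx : Middle x) where

    private
      y = inverse x

      x<p : x ℕ.< p
      x<p = Middle⇒<p mx

      p∤x : ¬ p ∣ x
      p∤x = Middle⇒p∤ mx

      x≢1 : x ≢ 1
      x≢1 refl = ℕP.<-irrefl refl (proj₁ mx)

      x≢p-1 : x ≢ p′
      x≢p-1 refl = ℕP.<-irrefl refl (proj₂ mx)

      yx≡1 : + y * + x ≡ + 1 [mod P ]
      yx≡1 = ≡mod-trans (≡mod-reflexive (ℤP.*-comm (+ y) (+ x))) (*-inverse≡1 p∤x)

      y≡self-inverse⇒x≡y : ∀ {z} → y ≡ z → + z * + z ≡ + 1 [mod P ] → x ≡ z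
      y≡self-inverse⇒x≡y refl yy≡1 = residue-injective x<p (inverse<p x) (inverse-unique {a = + y} yx≡1 yy≡1)

    inverse-Middle : Middle y
    inverse-Middle = ≢0∧≢1⇒≥2 y≢0 (λ y≡1 → x≢1 (y≡self-inverse⇒x≡y y≡1 ≡mod-refl))
                   , ℕP.≤-pred (ℕP.≤∧≢⇒< (ℕP.≤-pred (inverse<p x))
                                         (λ y≡p-1 → x≢p-1 (y≡self-inverse⇒x≡y y≡p-1 [p-1]²≡1)))
      where
      [p-1]²≡1 : + p′ * + p′ ≡ + 1 [mod P ]
      [p-1]²≡1 = ≡mod-* (pred≡-1 p′) (pred≡-1 p′)
      y≢0 : y ≢ 0
      y≢0 y≡0 = contradiction (residue-injective {p} {0} {1} (s≤s z≤n) (s≤s (s≤s z≤n)) 0≡1) λ ()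
        where
        0≡1 : + 0 ≡ + 1 [mod P ]
        0≡1 = subst (λ z → + z * + x ≡ + 1 [mod P ]) y≡0 yx≡1

    inverse-not-fixed : y ≢ x
    inverse-not-fixed y≡x with square≡1⇒≡±1 prime (subst (λ z → + x * + z ≡ + 1 [mod P ]) y≡x (*-inverse≡1 p∤x))
    ... | inj₁ x≡1  = x≢1 (residue-injective x<p (s≤s (s≤s z≤n)) x≡1)
    ... | inj₂ x≡-1 = x≢p-1 (residue-injective x<p ℕP.≤-refl (≡mod-trans x≡-1 (≡mod-sym (pred≡-1 p′))))

    inverse-involutive : inverse y ≡ x
    inverse-involutive = residue-injective (inverse<p y) x<p
      (inverse-unique {a = + y} (*-inverse≡1 (Middle⇒p∤ inverse-Middle)) yx≡1)

  middleResidues-pairing : InversePairing P inverse middleResidues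
  middleResidues-pairing = record
    { closed       = λ x∈ → Middle⇒∈middleResidues (inverse-Middle (∈middleResidues⇒Middle x∈))
    ; fixpointFree = λ x∈ → inverse-not-fixed (∈middleResidues⇒Middle x∈)
    ; involutive   = λ x∈ → inverse-involutive (∈middleResidues⇒Middle x∈)
    ; inverse      = λ x∈ → *-inverse≡1 (Middle⇒p∤ (∈middleResidues⇒Middle x∈))
    }

  wilson-odd : + (p′ !) ≡ -1ℤ [mod P ]
  wilson-odd = begin
    + (p′ !)                                   ≡⟨ ℤP.pos-* p′ (suc r !) ⟩
    + p′ * + (suc r !)                         ≡⟨ cong (λ n → + p′ * + n) (product[2,1+k]≡[1+k]! r) ⟨
    + p′ * + product middleResidues            ≈⟨ ≡mod-* (pred≡-1 p′) (product-paired≡1 _ ℕP.≤-refl unique-middleResidues middleResidues-pairing) ⟩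
    -1ℤ * + 1                                  ∎
    where open ≡mod-Reasoning P

wilson : ∀ {p} → Prime p → + ((p ∸ 1) !) ≡ -1ℤ [mod + p ]
wilson {0}                 p-prime = ⊥-elim (¬prime[0] p-prime)
wilson {1}                 p-prime = ⊥-elim (¬prime[1] p-prime)
wilson {2}                 _       = + 1 , refl
wilson {suc (suc (suc r))} p-prime = wilson-odd p-prime

-- Shifted products and harmonic numerators

∏ : ℕ → (ℕ → ℤ) → ℤ
∏ zero    f = + 1
∏ (suc k) f = ∏ k f * f (suc k)

∏-cong : ∀ k {f g : ℕ → ℤ} → (∀ r → r ℕ.≤ k → f r ≡ g r) → ∏ k f ≡ ∏ k g
∏-cong zero    f≗g = refl
∏-cong (suc k) f≗g = cong₂ _*_ (∏-cong k (λ r r≤k → f≗g r (ℕP.m≤n⇒m≤1+n r≤k))) (f≗g (suc k) ℕP.≤-refl)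

∏-shift : ∀ k f → ∏ (suc k) f ≡ f 1 * ∏ k (λ r → f (suc r))
∏-shift zero    f = trans (ℤP.*-identityˡ (f 1)) (sym (ℤP.*-identityʳ (f 1)))
∏-shift (suc k) f = trans (cong (_* f (suc (suc k))) (∏-shift k f)) (ℤP.*-assoc (f 1) _ _)

∏-reverse : ∀ k f → ∏ k f ≡ ∏ k (λ r → f (suc k ∸ r))
∏-reverse zero    f = refl
∏-reverse (suc k) f = begin
  ∏ k f * f (suc k)                           ≡⟨ cong (_* f (suc k)) (∏-reverse k f) ⟩
  ∏ k (λ r → f (suc k ∸ r)) * f (suc k)       ≡⟨ ℤP.*-comm _ (f (suc k)) ⟩
  f (suc k) * ∏ k (λ r → f (suc k ∸ r))       ≡⟨ ∏-shift k (λ r → f (suc (suc k) ∸ r)) ⟨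
  ∏ (suc k) (λ r → f (suc (suc k) ∸ r))       ∎
  where open ≡-Reasoning

∏-neg : ∀ k f → ∏ k (λ r → - f r) ≡ -1ℤ ^ k * ∏ k f
∏-neg zero    f = refl
∏-neg (suc k) f = trans (cong (_* - f (suc k)) (∏-neg k f)) (ring (-1ℤ ^ k) (∏ k f) (f (suc k)))
  where ring : ∀ s x y → s * x * - y ≡ -1ℤ * s * (x * y)
        ring = solve-∀

∏-pos : ∀ k → ∏ k (λ r → + r) ≡ + (k !)
∏-pos zero    = refl
∏-pos (suc k) = trans (cong (_* + suc k) (∏-pos k)) (trans (ℤP.*-comm (+ (k !)) (+ suc k)) (sym (ℤP.pos-* (suc k) (k !))))

-- k! · H_k
harmonicNumerator : ℕ → ℕ
harmonicNumerator zero    = 0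
harmonicNumerator (suc k) = suc k ℕ.* harmonicNumerator k ℕ.+ k !

pos-harmonicNumerator : ∀ k → + harmonicNumerator (suc k) ≡ + suc k * + harmonicNumerator k + + (k !)
pos-harmonicNumerator k = trans (ℤP.pos-+ (suc k ℕ.* harmonicNumerator k) (k !))
                                (cong (_+ + (k !)) (ℤP.pos-* (suc k) (harmonicNumerator k)))

∏-shifted-expansion : ∀ P c k →
  ∏ k (λ r → c * P + + r) ≡ + (k !) + c * P * + harmonicNumerator k [mod P * P ]
∏-shifted-expansion P c zero    = ≡mod-reflexive (ring c P)
  where ring : ∀ c P → + 1 ≡ + 1 + c * P * + 0
        ring = solve-∀
∏-shifted-expansion P c (suc k) = begin
  ∏ k (λ r → c * P + + r) * (c * P + K)        ≈⟨ ≡mod-* (∏-shifted-expansion P c k) ≡mod-refl ⟩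
  (F + c * P * S) * (c * P + K)                 ≈⟨ c * c * S , ring F S K c P ⟩
  K * F + c * P * (K * S + F)                   ≡⟨ cong₂ (λ u v → u + c * P * v) (sym (ℤP.pos-* (suc k) (k !)))
                                                                                   (sym (pos-harmonicNumerator k)) ⟩
  + (suc k !) + c * P * + harmonicNumerator (suc k) ∎
  where
  open ≡mod-Reasoning (P * P)
  F = + (k !)
  S = + harmonicNumerator k
  K = + suc k
  ring : ∀ F S K c P → (F + c * P * S) * (c * P + K) ≡ K * F + c * P * (K * S + F) + c * c * S * (P * P)
  ring = solve-∀

∏[r-p]≡[p-1]! : ∀ h → let n = h ℕ.+ h in ∏ n (λ r → -1ℤ * + suc n + + r) ≡ + (n !)
∏[r-p]≡[p-1]! h = begin
  ∏ n (λ r → -1ℤ * P + + r)             ≡⟨ ∏-reverse n _ ⟩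
  ∏ n (λ r → -1ℤ * P + + (suc n ∸ r))   ≡⟨ ∏-cong n reflect ⟩
  ∏ n (λ r → - + r)                     ≡⟨ ∏-neg n (λ r → + r) ⟩
  -1ℤ ^ n * ∏ n (λ r → + r)             ≡⟨ cong₂ _*_ (-1^[h+h]≡1 h) (∏-pos n) ⟩
  + 1 * + (n !)                         ≡⟨ ℤP.*-identityˡ (+ (n !)) ⟩
  + (n !)                               ∎
  where
  open ≡-Reasoning
  n = h ℕ.+ h
  P = + suc n
  reflect : ∀ r → r ℕ.≤ n → -1ℤ * P + + (suc n ∸ r) ≡ - + r
  reflect r r≤n = trans (cong (λ x → -1ℤ * P + x) (pos-∸ (ℕP.m≤n⇒m≤1+n r≤n))) (ring P (+ r))
    where ring : ∀ P r → -1ℤ * P + (P - r) ≡ - r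
          ring = solve-∀

-- Reflecting r ↦ p − r gives ∏_{r<p} (r − p) = (p − 1)!, while the expansion above
-- gives (p − 1)! − p·(p − 1)!·H_{p−1} modulo p².
harmonicNumerator[p-1]≡0 : ∀ h → + harmonicNumerator (h ℕ.+ h) ≡ + 0 [mod + suc (h ℕ.+ h) ]
harmonicNumerator[p-1]≡0 h = ≡mod-unscaleˡ P (begin
  P * S                                  ≡⟨ ring₁ F P S ⟩
  F - (F + -1ℤ * P * S)                  ≈⟨ ≡mod-- (≡mod-refl {a = F}) (≡mod-sym (∏-shifted-expansion P -1ℤ n)) ⟩
  F - ∏ n (λ r → -1ℤ * P + + r)          ≡⟨ cong (λ x → F - x) (∏[r-p]≡[p-1]! h) ⟩
  F - F                                  ≡⟨ ring₂ F P ⟩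
  P * + 0                                ∎)
  where
  n = h ℕ.+ h
  P = + suc n
  F = + (n !)
  S = + harmonicNumerator n
  open ≡mod-Reasoning (P * P)
  ring₁ : ∀ F P S → P * S ≡ F - (F + -1ℤ * P * S)
  ring₁ = solve-∀
  ring₂ : ∀ F P → F - F ≡ P * + 0
  ring₂ = solve-∀

powerSum : ℕ → ℕ → ℤ
powerSum e zero    = + 0
powerSum e (suc k) = powerSum e k + (+ suc k) ^ e

-- Gauss factorials modulo p²

module _ {p : ℕ} (prime : Prime p) where

  gaussFact-∣ : ∀ {N} → p ∣ suc N → gaussFact (suc N) p ≡ gaussFact N p
  gaussFact-∣ {N} p∣1+N = step (gcd (suc N) p ℕ.≟ 1)
    where
    step : (d : Dec (gcd (suc N) p ≡ 1)) → (if does d then suc N else 1) ℕ.* gaussFact N p ≡ gaussFact N p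
    step (yes gcd≡1) = ⊥-elim (ℕ.nonTrivial⇒≢1 {{prime⇒nonTrivial prime}}
                                (ℕD.∣1⇒≡1 (subst (p ∣_) gcd≡1 (gcd-greatest p∣1+N ℕD.∣-refl))))
    step (no  _)     = ℕP.+-identityʳ (gaussFact N p)

  gaussFact-∤ : ∀ {N} → ¬ p ∣ suc N → gaussFact (suc N) p ≡ suc N ℕ.* gaussFact N p
  gaussFact-∤ {N} p∤1+N = step (gcd (suc N) p ℕ.≟ 1)
    where
    step : (d : Dec (gcd (suc N) p ≡ 1)) → (if does d then suc N else 1) ℕ.* gaussFact N p ≡ suc N ℕ.* gaussFact N p
    step (yes _)     = refl
    step (no gcd≢1) with prime⇒irreducible prime (gcd[m,n]∣n (suc N) p)
    ... | inj₁ gcd≡1 = ⊥-elim (gcd≢1 gcd≡1)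
    ... | inj₂ gcd≡p = ⊥-elim (p∤1+N (subst (_∣ suc N) gcd≡p (gcd[m,n]∣m (suc N) p)))

  gaussFact-block : ∀ c r → r ℕ.< p →
    + gaussFact (c ℕ.* p ℕ.+ r) p ≡ + gaussFact (c ℕ.* p) p * ∏ r (λ s → + c * + p + + s)
  gaussFact-block c zero    _     = trans (cong (λ N → + gaussFact N p) (ℕP.+-identityʳ (c ℕ.* p))) (sym (ℤP.*-identityʳ _))
  gaussFact-block c (suc r) 1+r<p = begin
    + gaussFact (c ℕ.* p ℕ.+ suc r) p                                ≡⟨ cong (λ N → + gaussFact N p) (ℕP.+-suc (c ℕ.* p) r) ⟩
    + gaussFact (suc (c ℕ.* p ℕ.+ r)) p                              ≡⟨ cong +_ (gaussFact-∤ p∤) ⟩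
    + (suc (c ℕ.* p ℕ.+ r) ℕ.* gaussFact (c ℕ.* p ℕ.+ r) p)          ≡⟨ ℤP.pos-* (suc (c ℕ.* p ℕ.+ r)) _ ⟩
    + suc (c ℕ.* p ℕ.+ r) * + gaussFact (c ℕ.* p ℕ.+ r) p            ≡⟨ cong₂ _*_ cp+1+r (gaussFact-block c r (ℕP.<-trans (ℕP.n<1+n r) 1+r<p)) ⟩
    (+ c * + p + + suc r) * (G * ∏ r (λ s → + c * + p + + s))         ≡⟨ ring (+ c * + p + + suc r) G (∏ r (λ s → + c * + p + + s)) ⟩
    G * (∏ r (λ s → + c * + p + + s) * (+ c * + p + + suc r))         ∎
    where
    open ≡-Reasoning
    G = + gaussFact (c ℕ.* p) p
    p∤ : ¬ p ∣ suc (c ℕ.* p ℕ.+ r)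
    p∤ = subst (λ N → ¬ p ∣ N) (ℕP.+-suc (c ℕ.* p) r) (∤-multiple+small c (s≤s z≤n) 1+r<p)
    cp+1+r : + suc (c ℕ.* p ℕ.+ r) ≡ + c * + p + + suc r
    cp+1+r = trans (cong +_ (sym (ℕP.+-suc (c ℕ.* p) r))) (trans (ℤP.pos-+ (c ℕ.* p) (suc r)) (cong (_+ + suc r) (ℤP.pos-* c p)))
    ring : ∀ x g q → x * (g * q) ≡ g * (q * x)
    ring = solve-∀

-- p · m · n! times the right-hand side (1/m)(w_p − H_n) − Σ_{a=1}^{n} q_p(a) of the theorem
rhsNumerator : ℕ → ℕ → ℕ → ℤ
rhsNumerator p m n = + (n !) * (+ ((p ∸ 1) !) + + 1) - + harmonicNumerator n * + p
                     - + m * + (n !) * (powerSum (p ∸ 1) n - + n)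

module _ {h : ℕ} (prime : Prime (suc (suc h ℕ.+ suc h))) where

  private
    p′ = suc h ℕ.+ suc h
    p  = suc p′
    P  = + p
    A  = + (p′ !)

  ∏[cp+s]≡[p-1]! : ∀ c → ∏ p′ (λ s → + c * P + + s) ≡ A [mod P * P ]
  ∏[cp+s]≡[p-1]! c = begin
    ∏ p′ (λ s → + c * P + + s)                ≈⟨ ∏-shifted-expansion P (+ c) p′ ⟩
    A + + c * P * S                           ≡⟨ cong (_+_ A) (ℤP.*-assoc (+ c) P S) ⟩
    A + + c * (P * S)                         ≈⟨ ≡mod-+ (≡mod-refl {a = A}) (≡mod-* (≡mod-refl {a = + c}) (≡mod-scaleˡ P (harmonicNumerator[p-1]≡0 (suc h)))) ⟩
    A + + c * (P * + 0)                       ≡⟨ ring A (+ c) P ⟩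
    A                                         ∎
    where
    open ≡mod-Reasoning (P * P)
    S = + harmonicNumerator p′
    ring : ∀ A c P → A + c * (P * + 0) ≡ A
    ring = solve-∀

  gaussFact[cp]≡[p-1]!^c : ∀ c → + gaussFact (c ℕ.* p) p ≡ A ^ c [mod P * P ]
  gaussFact[cp]≡[p-1]!^c zero    = ≡mod-refl
  gaussFact[cp]≡[p-1]!^c (suc c) = begin
    + gaussFact (suc c ℕ.* p) p                        ≡⟨ cong (λ N → + gaussFact N p) [1+c]p≡1+[cp+p′] ⟩
    + gaussFact (suc (c ℕ.* p ℕ.+ p′)) p               ≡⟨ cong +_ (gaussFact-∣ prime (subst (p ∣_) [1+c]p≡1+[cp+p′] (ℕD.n∣m*n (suc c)))) ⟩
    + gaussFact (c ℕ.* p ℕ.+ p′) p                     ≡⟨ gaussFact-block prime c p′ (ℕP.n<1+n p′) ⟩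
    + gaussFact (c ℕ.* p) p * ∏ p′ (λ s → + c * P + + s) ≈⟨ ≡mod-* (gaussFact[cp]≡[p-1]!^c c) (∏[cp+s]≡[p-1]! c) ⟩
    A ^ c * A                                          ≡⟨ ℤP.*-comm (A ^ c) A ⟩
    A ^ suc c                                          ∎
    where
    open ≡mod-Reasoning (P * P)
    [1+c]p≡1+[cp+p′] : suc c ℕ.* p ≡ suc (c ℕ.* p ℕ.+ p′)
    [1+c]p≡1+[cp+p′] = trans (ℕP.+-comm p (c ℕ.* p)) (ℕP.+-suc (c ℕ.* p) p′)

  gaussFact[np+n]-expansion : ∀ n → n ℕ.< p →
    + gaussFact (n ℕ.* p ℕ.+ n) p ≡ A ^ n * (+ (n !) + + n * P * + harmonicNumerator n) [mod P * P ]
  gaussFact[np+n]-expansion n n<p = ≡mod-trans (≡mod-reflexive (gaussFact-block prime n n n<p))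
                                     (≡mod-* (gaussFact[cp]≡[p-1]!^c n) (∏-shifted-expansion P (+ n) n))

  powerSum≡k : ∀ k → k ℕ.< p → powerSum p′ k - + k ≡ + 0 [mod P ]
  powerSum≡k zero    _     = ≡mod-refl
  powerSum≡k (suc k) 1+k<p = begin
    powerSum p′ k + (+ suc k) ^ p′ - + suc k          ≡⟨ ring (powerSum p′ k) ((+ suc k) ^ p′) (+ k) ⟩
    (powerSum p′ k - + k) + ((+ suc k) ^ p′ - + 1)    ≈⟨ ≡mod-+ (powerSum≡k k (ℕP.<-trans (ℕP.n<1+n k) 1+k<p))
                                                               (≡mod-- (fermat prime (ℕD.>⇒∤ 1+k<p)) (≡mod-refl {a = + 1})) ⟩
    + 0 + (+ 1 - + 1)                                 ∎
    where
    open ≡mod-Reasoning P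
    ring : ∀ T x k → T + x - (+ 1 + k) ≡ (T - k) + (x - + 1)
    ring = solve-∀

  [k!]^[p-1] : ∀ k → k ℕ.< p → (+ (k !)) ^ p′ ≡ + 1 + (powerSum p′ k - + k) [mod P * P ]
  [k!]^[p-1] zero    _     = ≡mod-reflexive (ℤP.^-zeroˡ p′)
  [k!]^[p-1] (suc k) 1+k<p = begin
    (+ (suc k !)) ^ p′                                   ≡⟨ cong (_^ p′) (ℤP.pos-* (suc k) (k !)) ⟩
    (+ suc k * + (k !)) ^ p′                             ≡⟨ ^-distribʳ-* (+ suc k) (+ (k !)) p′ ⟩
    (+ suc k) ^ p′ * (+ (k !)) ^ p′                      ≈⟨ ≡mod-* (≡mod-reflexive (ring₁ ((+ suc k) ^ p′))) ([k!]^[p-1] k k<p) ⟩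
    (+ 1 + ((+ suc k) ^ p′ - + 1)) * (+ 1 + (powerSum p′ k - + k))
                                                         ≈⟨ [1+a][1+b]≡1+a+b (≡mod-- (fermat prime (ℕD.>⇒∤ 1+k<p)) (≡mod-refl {a = + 1})) (powerSum≡k k k<p) ⟩
    + 1 + (((+ suc k) ^ p′ - + 1) + (powerSum p′ k - + k)) ≡⟨ ring₂ (powerSum p′ k) ((+ suc k) ^ p′) (+ k) ⟩
    + 1 + (powerSum p′ (suc k) - + suc k)                ∎
    where
    open ≡mod-Reasoning (P * P)
    k<p = ℕP.<-trans (ℕP.n<1+n k) 1+k<p
    ring₁ : ∀ x → x ≡ + 1 + (x - + 1)
    ring₁ = solve-∀
    ring₂ : ∀ T x k → + 1 + ((x - + 1) + (T - k)) ≡ + 1 + (T + x - (+ 1 + k))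
    ring₂ = solve-∀

  private
    w : ℤ
    w = _≡_[mod_].quotient (wilson prime)
    A≡-1+wP : A ≡ -1ℤ + w * P
    A≡-1+wP = _≡_[mod_].equation (wilson prime)

  [p-1]!^[p-1] : A ^ p′ ≡ + 1 + P * - (+ p′ * w) [mod P * P ]
  [p-1]!^[p-1] = begin
    A ^ p′                                             ≡⟨ cong (_^ p′) (trans A≡-1+wP (cong (_+_ -1ℤ) (ℤP.*-comm w P))) ⟩
    (-1ℤ + P * w) ^ p′                                 ≈⟨ [u+Pv]^[1+k] P -1ℤ w (h ℕ.+ suc h) ⟩
    -1ℤ ^ p′ + P * (+ p′ * -1ℤ ^ (h ℕ.+ suc h) * w)    ≡⟨ cong₂ (λ a b → a + P * (+ p′ * b * w)) (-1^[h+h]≡1 (suc h)) -1^[h+1+h]≡-1 ⟩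
    + 1 + P * (+ p′ * -1ℤ * w)                         ≡⟨ ring P (+ p′) w ⟩
    + 1 + P * - (+ p′ * w)                             ∎
    where
    open ≡mod-Reasoning (P * P)
    -1^[h+1+h]≡-1 : -1ℤ ^ (h ℕ.+ suc h) ≡ -1ℤ
    -1^[h+1+h]≡-1 = trans (cong (-1ℤ ^_) (ℕP.+-suc h h)) (trans (cong (-1ℤ *_) (-1^[h+h]≡1 h)) (ℤP.*-identityʳ -1ℤ))
    ring : ∀ P q w → + 1 + P * (q * -1ℤ * w) ≡ + 1 + P * - (q * w)
    ring = solve-∀

  n!·G^[p-1] : ∀ n E → n ℕ.< p → powerSum p′ n - + n ≡ E * P →
    + (n !) * (+ gaussFact (n ℕ.* p ℕ.+ n) p) ^ p′
      ≡ + (n !) + P * (E * + (n !) + + p′ * (+ n * + harmonicNumerator n) - + n * (+ p′ * w) * + (n !)) [mod P * P ]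
  n!·G^[p-1] n E n<p D≡EP = begin
    K * G ^ p′
      ≈⟨ ≡mod-* (≡mod-refl {a = K}) (≡mod-^ p′ (gaussFact[np+n]-expansion n n<p)) ⟩
    K * (A ^ n * (K + + n * P * S)) ^ p′
      ≡⟨ cong (K *_) power-rearrange ⟩
    K * ((A ^ p′) ^ n * (K + P * (+ n * S)) ^ p′)
      ≡⟨ ring₁ K ((A ^ p′) ^ n) ((K + P * (+ n * S)) ^ p′) ⟩
    (A ^ p′) ^ n * (K * (K + P * (+ n * S)) ^ p′)
      ≈⟨ ≡mod-* Aᵖⁿ≡ Kᵖ≡ ⟩
    (+ 1 + P * (+ n * - (+ p′ * w))) * (K + P * (E * K + + p′ * (+ n * S)))
      ≈⟨ + n * - (+ p′ * w) * (E * K + + p′ * (+ n * S)) , ring₂ K S w E (+ n) (+ p′) P ⟩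
    K + P * (E * K + + p′ * (+ n * S) - + n * (+ p′ * w) * K) ∎
    where
    open ≡mod-Reasoning (P * P)
    K = + (n !)
    S = + harmonicNumerator n
    G = + gaussFact (n ℕ.* p ℕ.+ n) p
    ring₀ : ∀ K n P S → K + n * P * S ≡ K + P * (n * S)
    ring₀ = solve-∀
    power-rearrange : (A ^ n * (K + + n * P * S)) ^ p′ ≡ (A ^ p′) ^ n * (K + P * (+ n * S)) ^ p′
    power-rearrange = trans (^-distribʳ-* (A ^ n) _ p′)
      (cong₂ _*_ (trans (ℤP.^-*-assoc A n p′) (trans (cong (A ^_) (ℕP.*-comm n p′)) (sym (ℤP.^-*-assoc A p′ n))))
                 (cong (_^ p′) (ring₀ K (+ n) P S)))
    Aᵖⁿ≡ : (A ^ p′) ^ n ≡ + 1 + P * (+ n * - (+ p′ * w)) [mod P * P ]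
    Aᵖⁿ≡ = ≡mod-trans (≡mod-^ n [p-1]!^[p-1]) ([1+Pv]^k P (- (+ p′ * w)) n)
    Kᵖ≡ : K * (K + P * (+ n * S)) ^ p′ ≡ K + P * (E * K + + p′ * (+ n * S)) [mod P * P ]
    Kᵖ≡ = K[K+PX]^[1+k] P K (+ n * S) E (h ℕ.+ suc h)
            (≡mod-trans ([k!]^[p-1] n n<p) (≡mod-reflexive (cong (_+_ (+ 1)) D≡EP)))
    ring₁ : ∀ K a y → K * (a * y) ≡ a * (K * y)
    ring₁ = solve-∀
    ring₂ : ∀ K S w E n q P → (+ 1 + P * (n * - (q * w))) * (K + P * (E * K + q * (n * S)))
                               ≡ K + P * (E * K + q * (n * S) - n * (q * w) * K) + n * - (q * w) * (E * K + q * (n * S)) * (P * P)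
    ring₂ = solve-∀

  key-congruence : ∀ m n → m ℕ.* n ≡ p′ → n ℕ.< p →
    + m * + (n !) * ((+ gaussFact (n ℕ.* p ℕ.+ n) p) ^ p′ - + 1) ≡ - rhsNumerator p m n [mod P * P ]
  key-congruence m n mn≡p′ n<p with powerSum≡k n n<p
  ... | E , D≡0+EP = begin
    c * K * (G ^ p′ - + 1)
      ≡⟨ ring₁ c K (G ^ p′) ⟩
    c * (K * G ^ p′) - c * K
      ≈⟨ ≡mod-- (≡mod-* (≡mod-refl {a = c}) (n!·G^[p-1] n E n<p D≡EP)) (≡mod-refl {a = c * K}) ⟩
    c * (K + P * (E * K + + p′ * (+ n * S) - + n * (+ p′ * w) * K)) - c * K
      ≡⟨ ring₂ c K S w E (+ n) (+ p′) P ⟩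
    P * (c * E * K + c * + n * + p′ * (S - w * K))
      ≡⟨ cong (λ x → P * (c * E * K + x * + p′ * (S - w * K))) cn≡p′ ⟩
    P * (c * E * K + + p′ * + p′ * (S - w * K))
      ≈⟨ ≡mod-scaleˡ P (≡mod-+ (≡mod-refl {a = c * E * K}) (≡mod-* [p-1]²≡1 (≡mod-refl {a = S - w * K}))) ⟩
    P * (c * E * K + + 1 * (S - w * K))
      ≡⟨ ring₃ c E K S w P ⟩
    - (K * ((-1ℤ + w * P) + + 1) - S * P - c * K * (E * P))
      ≡⟨ cong₂ (λ a d → - (K * (a + + 1) - S * P - c * K * d)) (sym A≡-1+wP) (sym D≡EP) ⟩
    - rhsNumerator p m n ∎
    where
    open ≡mod-Reasoning (P * P)
    c = + m
    K = + (n !)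
    S = + harmonicNumerator n
    G = + gaussFact (n ℕ.* p ℕ.+ n) p
    D≡EP : powerSum p′ n - + n ≡ E * P
    D≡EP = trans D≡0+EP (ℤP.+-identityˡ (E * P))
    cn≡p′ : c * + n ≡ + p′
    cn≡p′ = trans (sym (ℤP.pos-* m n)) (cong +_ mn≡p′)
    [p-1]²≡1 : + p′ * + p′ ≡ + 1 [mod P ]
    [p-1]²≡1 = ≡mod-* (pred≡-1 p′) (pred≡-1 p′)
    ring₁ : ∀ c K g → c * K * (g - + 1) ≡ c * (K * g) - c * K
    ring₁ = solve-∀
    ring₂ : ∀ c K S w E n q P → c * (K + P * (E * K + q * (n * S) - n * (q * w) * K)) - c * K
                                 ≡ P * (c * E * K + c * n * q * (S - w * K))
    ring₂ = solve-∀
    ring₃ : ∀ c E K S w P → P * (c * E * K + + 1 * (S - w * K)) ≡ - (K * ((-1ℤ + w * P) + + 1) - S * P - c * K * (E * P))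
    ring₃ = solve-∀

-- The rational side

infix 4 _≃ᵘ_/_ _≃_/_

record _≃ᵘ_/_ (x : ℚᵘ) (z : ℤ) (d : ℕ) : Set where
  constructor cross
  field
    cross-multiplied : ↥ᵘ x * + d ≡ z * ↧ᵘ x

≃ᵘ-resp-≃ : ∀ {x y z d} → x ℚᵘ.≃ y → y ≃ᵘ z / d → x ≃ᵘ z / d
≃ᵘ-resp-≃ {mkℚᵘ a b} {mkℚᵘ a′ b′} {z} {d} (*≡* ab′≡a′b) (cross a′d≡zb′) =
  cross (ℤP.*-cancelʳ-≡ (a * + d) (z * + suc b) (+ suc b′) (begin
  a * + d * + suc b′        ≡⟨ ring₁ a (+ d) (+ suc b′) ⟩
  a * + suc b′ * + d        ≡⟨ cong (_* + d) ab′≡a′b ⟩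
  a′ * + suc b * + d        ≡⟨ ring₁ a′ (+ suc b) (+ d) ⟩
  a′ * + d * + suc b        ≡⟨ cong (_* + suc b) a′d≡zb′ ⟩
  z * + suc b′ * + suc b    ≡⟨ ring₁ z (+ suc b′) (+ suc b) ⟩
  z * + suc b * + suc b′    ∎))
  where
  open ≡-Reasoning
  ring₁ : ∀ x y z → x * y * z ≡ x * z * y
  ring₁ = solve-∀

≃ᵘ-+ : ∀ {x y z z′ d d′} → x ≃ᵘ z / d → y ≃ᵘ z′ / d′ → x ℚᵘ.+ y ≃ᵘ z * + d′ + z′ * + d / d ℕ.* d′
≃ᵘ-+ {mkℚᵘ a b} {mkℚᵘ a′ b′} {z} {z′} {d} {d′} (cross ad≡zb) (cross a′d′≡z′b′) = cross (begin
  (a * B′ + a′ * B) * + (d ℕ.* d′)        ≡⟨ cong (λ e → (a * B′ + a′ * B) * e) (ℤP.pos-* d d′) ⟩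
  (a * B′ + a′ * B) * (+ d * + d′)         ≡⟨ ring₁ a B′ a′ B (+ d) (+ d′) ⟩
  a * + d * B′ * + d′ + a′ * + d′ * B * + d ≡⟨ cong₂ (λ u v → u * B′ * + d′ + v * B * + d) ad≡zb a′d′≡z′b′ ⟩
  z * B * B′ * + d′ + z′ * B′ * B * + d    ≡⟨ ring₂ z B B′ z′ (+ d) (+ d′) ⟩
  (z * + d′ + z′ * + d) * (B * B′)         ≡⟨ cong ((z * + d′ + z′ * + d) *_) (ℤP.pos-* (suc b) (suc b′)) ⟨
  (z * + d′ + z′ * + d) * + (suc b ℕ.* suc b′) ∎)
  where
  open ≡-Reasoning
  B = + suc b
  B′ = + suc b′
  ring₁ : ∀ a B′ a′ B d d′ → (a * B′ + a′ * B) * (d * d′) ≡ a * d * B′ * d′ + a′ * d′ * B * d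
  ring₁ = solve-∀
  ring₂ : ∀ z B B′ z′ d d′ → z * B * B′ * d′ + z′ * B′ * B * d ≡ (z * d′ + z′ * d) * (B * B′)
  ring₂ = solve-∀

≃ᵘ-* : ∀ {x y z z′ d d′} → x ≃ᵘ z / d → y ≃ᵘ z′ / d′ → x ℚᵘ.* y ≃ᵘ z * z′ / d ℕ.* d′
≃ᵘ-* {mkℚᵘ a b} {mkℚᵘ a′ b′} {z} {z′} {d} {d′} (cross ad≡zb) (cross a′d′≡z′b′) = cross (begin
  a * a′ * + (d ℕ.* d′)            ≡⟨ cong (a * a′ *_) (ℤP.pos-* d d′) ⟩
  a * a′ * (+ d * + d′)             ≡⟨ ring a a′ (+ d) (+ d′) ⟩
  (a * + d) * (a′ * + d′)           ≡⟨ cong₂ _*_ ad≡zb a′d′≡z′b′ ⟩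
  (z * + suc b) * (z′ * + suc b′)   ≡⟨ ring z (+ suc b) z′ (+ suc b′) ⟩
  z * z′ * (+ suc b * + suc b′)     ≡⟨ cong (z * z′ *_) (ℤP.pos-* (suc b) (suc b′)) ⟨
  z * z′ * + (suc b ℕ.* suc b′)     ∎)
  where
  open ≡-Reasoning
  ring : ∀ a a′ d d′ → a * a′ * (d * d′) ≡ (a * d) * (a′ * d′)
  ring = solve-∀

≃ᵘ-neg : ∀ {x z d} → x ≃ᵘ z / d → ℚᵘ.- x ≃ᵘ - z / d
≃ᵘ-neg {mkℚᵘ a b} {z} {d} (cross ad≡zb) =
  cross (trans (sym (ℤP.neg-distribˡ-* a (+ d))) (trans (cong -_ ad≡zb) (ℤP.neg-distribˡ-* z _)))

≃ᵘ-cancel : ∀ {x z d} c → x ≃ᵘ z * + suc c / d ℕ.* suc c → x ≃ᵘ z / d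
≃ᵘ-cancel {x} {z} {d} c (cross eq) = cross (ℤP.*-cancelʳ-≡ (↥ᵘ x * + d) (z * ↧ᵘ x) (+ suc c) (begin
  ↥ᵘ x * + d * + suc c            ≡⟨ ℤP.*-assoc (↥ᵘ x) (+ d) (+ suc c) ⟩
  ↥ᵘ x * (+ d * + suc c)          ≡⟨ cong (↥ᵘ x *_) (ℤP.pos-* d (suc c)) ⟨
  ↥ᵘ x * + (d ℕ.* suc c)          ≡⟨ eq ⟩
  z * + suc c * ↧ᵘ x              ≡⟨ ring z (+ suc c) (↧ᵘ x) ⟩
  z * ↧ᵘ x * + suc c              ∎))
  where
  open ≡-Reasoning
  ring : ∀ z c q → z * c * q ≡ z * q * c
  ring = solve-∀

_≃_/_ : ℚ → ℤ → ℕ → Set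
x ≃ z / d = toℚᵘ x ≃ᵘ z / d

≃-/ℚ : ∀ z d → z /ℚ suc d ≃ z / suc d
≃-/ℚ z d = ≃ᵘ-resp-≃ {toℚᵘ (fromℚᵘ (mkℚᵘ z d))} (ℚP.toℚᵘ-fromℚᵘ (mkℚᵘ z d)) (cross refl)

≃-+ : ∀ {x y z z′ d d′} → x ≃ z / d → y ≃ z′ / d′ → x ℚ.+ y ≃ z * + d′ + z′ * + d / d ℕ.* d′
≃-+ {x} {y} x≃ y≃ = ≃ᵘ-resp-≃ {toℚᵘ (x ℚ.+ y)} (ℚP.toℚᵘ-homo-+ x y) (≃ᵘ-+ {toℚᵘ x} {toℚᵘ y} x≃ y≃)

≃-* : ∀ {x y z z′ d d′} → x ≃ z / d → y ≃ z′ / d′ → x ℚ.* y ≃ z * z′ / d ℕ.* d′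
≃-* {x} {y} x≃ y≃ = ≃ᵘ-resp-≃ {toℚᵘ (x ℚ.* y)} (ℚP.toℚᵘ-homo-* x y) (≃ᵘ-* {toℚᵘ x} {toℚᵘ y} x≃ y≃)

≃-neg : ∀ {x z d} → x ≃ z / d → ℚ.- x ≃ - z / d
≃-neg {x} x≃ = ≃ᵘ-resp-≃ {toℚᵘ (ℚ.- x)} (ℚP.toℚᵘ-homo‿- x) (≃ᵘ-neg {toℚᵘ x} x≃)

≃-cancel : ∀ {x z d} c → x ≃ z * + suc c / d ℕ.* suc c → x ≃ z / d
≃-cancel c = ≃ᵘ-cancel c

≃-subst : ∀ {x z z′ d d′} → z ≡ z′ → d ≡ d′ → x ≃ z / d → x ≃ z′ / d′
≃-subst refl refl x≃ = x≃

≃⇒↥*≡*↧ : ∀ {x z d} → x ≃ z / d → ↥ x * + d ≡ z * ↧ x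
≃⇒↥*≡*↧ {x} {z} {d} (cross x≃) = trans (cong (_* + d) (sym (ℚP.↥ᵘ-toℚᵘ x))) (trans x≃ (cong (z *_) (ℚP.↧ᵘ-toℚᵘ x)))

coprime-↥↧ : ∀ x → Coprime ℤ.∣ ↥ x ∣ (↧ₙ x)
coprime-↥↧ (ℚ.mkℚ n d c) = recompute (coprime? ℤ.∣ n ∣ (suc d)) c

harmonic≃ : ∀ k → harmonic k ≃ + harmonicNumerator k / k !
harmonic≃ zero    = cross refl
harmonic≃ (suc k) = ≃-subst numerator (ℕP.*-comm (k !) (suc k)) (≃-+ (harmonic≃ k) (≃-/ℚ (+ 1) k))
  where
  numerator : + harmonicNumerator k * + suc k + + 1 * + (k !) ≡ + harmonicNumerator (suc k)
  numerator = trans (ring (+ harmonicNumerator k) (+ suc k) (+ (k !))) (sym (pos-harmonicNumerator k))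
    where ring : ∀ S K F → S * K + + 1 * F ≡ K * S + F
          ring = solve-∀

module _ (p′ : ℕ) where

  private
    p = suc p′
    P = + p

  fermatQuotientSum≃ : ∀ k → sumFrom1 k (fermatQuotient p) ≃ powerSum p′ k - + k / p
  fermatQuotientSum≃ zero    = cross refl
  fermatQuotientSum≃ (suc k) =
    ≃-cancel p′ (≃-subst numerator refl (≃-+ (fermatQuotientSum≃ k) (≃-/ℚ (+ (suc k ℕ.^ p′) - + 1) p′)))
    where
    numerator : (powerSum p′ k - + k) * P + (+ (suc k ℕ.^ p′) - + 1) * P ≡ (powerSum p′ (suc k) - + suc k) * P
    numerator = trans (cong (λ a → (powerSum p′ k - + k) * P + (a - + 1) * P) (pos-^ (suc k) p′))
                      (ring (powerSum p′ k) (+ k) ((+ suc k) ^ p′) P)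
      where ring : ∀ T k a P → (T - k) * P + (a - + 1) * P ≡ (T + a - (+ 1 + k)) * P
            ring = solve-∀

  rhs≃ : ∀ m′ n → ((+ 1) /ℚ suc m′) ℚ.* (wilsonQuotient p ℚ.- harmonic n) ℚ.- sumFrom1 n (fermatQuotient p)
                  ≃ rhsNumerator p (suc m′) n / suc m′ ℕ.* (p ℕ.* n !)
  rhs≃ m′ n = ≃-cancel p′ (≃-subst numerator refl
    (≃-+ (≃-* (≃-/ℚ (+ 1) m′) (≃-+ (≃-/ℚ (+ (p′ ! ℕ.+ 1)) p′) (≃-neg (harmonic≃ n))))
         (≃-neg (fermatQuotientSum≃ n))))
    where
    c = + suc m′
    K = + (n !)
    numerator : + 1 * (+ (p′ ! ℕ.+ 1) * K + - + harmonicNumerator n * P) * P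
                + - (powerSum p′ n - + n) * + (suc m′ ℕ.* (p ℕ.* n !)) ≡ rhsNumerator p (suc m′) n * P
    numerator = trans (cong₂ (λ a d → + 1 * (a * K + - + harmonicNumerator n * P) * P + - (powerSum p′ n - + n) * d)
                             (ℤP.pos-+ (p′ !) 1) (trans (ℤP.pos-* (suc m′) (p ℕ.* n !)) (cong (c *_) (ℤP.pos-* p (n !)))))
                      (ring (+ (p′ !)) K (+ harmonicNumerator n) P c (powerSum p′ n) (+ n))
      where ring : ∀ A K S P c T n → + 1 * ((A + + 1) * K + - S * P) * P + - (T - n) * (c * (P * K))
                                      ≡ (K * (A + + 1) - S * P - c * K * (T - n)) * P
            ring = solve-∀

module _ {p : ℕ} (prime : Prime p) where

  private
    instance _ = prime⇒nonZero prime

  prime²∣*⇒∣ : ∀ {c y} → ¬ p ∣ c → p ℕ.* p ∣ c ℕ.* y → p ℕ.* p ∣ y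
  prime²∣*⇒∣ {c} {y} p∤c p²∣cy with euclidsLemma c y prime (ℕD.∣-trans (ℕD.m∣m*n p) p²∣cy)
  ... | inj₁ p∣c = ⊥-elim (p∤c p∣c)
  ... | inj₂ (divides y′ refl) with euclidsLemma c y′ prime (ℕD.*-cancelʳ-∣ p (subst (p ℕ.* p ∣_) (ring₁ c y′ p) p²∣cy))
    where ring₁ : ∀ c y p → c ℕ.* (y ℕ.* p) ≡ c ℕ.* y ℕ.* p
          ring₁ = ℕ-Solver.solve-∀
  ...   | inj₁ p∣c              = ⊥-elim (p∤c p∣c)
  ...   | inj₂ (divides y″ refl) = divides y″ (ring₂ y″ p)
    where ring₂ : ∀ y p → y ℕ.* p ℕ.* p ≡ y ℕ.* (p ℕ.* p)
          ring₂ = ℕ-Solver.solve-∀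

  lowest-terms-≡0⇔ : ∀ {a b y D} → Coprime a b → a ℕ.* D ≡ y ℕ.* b → p ∣ D → ¬ p ℕ.* p ∣ D →
                      (p ∣ a × ¬ p ∣ b) ⇔ p ℕ.* p ∣ y
  lowest-terms-≡0⇔ {a} {b} {y} coprime aD≡yb (divides D′ refl) p²∤D = mk⇔ to from
    where
    p∤D′ : ¬ p ∣ D′
    p∤D′ (divides D″ refl) = p²∤D (divides D″ (ring D″ p))
      where ring : ∀ D p → D ℕ.* p ℕ.* p ≡ D ℕ.* (p ℕ.* p)
            ring = ℕ-Solver.solve-∀
    to : p ∣ a × ¬ p ∣ b → p ℕ.* p ∣ y
    to (divides a′ refl , p∤b) = prime²∣*⇒∣ p∤b (divides (a′ ℕ.* D′) (trans (ℕP.*-comm b y) (trans (sym aD≡yb) (ring a′ p D′))))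
      where ring : ∀ a p D → a ℕ.* p ℕ.* (D ℕ.* p) ≡ a ℕ.* D ℕ.* (p ℕ.* p)
            ring = ℕ-Solver.solve-∀
    from : p ℕ.* p ∣ y → p ∣ a × ¬ p ∣ b
    from (divides y′ refl) = p∣a , λ p∣b → ℕ.nonTrivial⇒≢1 {{prime⇒nonTrivial prime}} (coprime (p∣a , p∣b))
      where
      p∣aD′ : p ∣ a ℕ.* D′
      p∣aD′ = ℕD.*-cancelʳ-∣ p (divides (y′ ℕ.* b) (trans (ring₁ a D′ p) (trans aD≡yb (ring₂ y′ p b))))
        where ring₁ : ∀ a D p → a ℕ.* D ℕ.* p ≡ a ℕ.* (D ℕ.* p)
              ring₁ = ℕ-Solver.solve-∀
              ring₂ : ∀ y p b → y ℕ.* (p ℕ.* p) ℕ.* b ≡ y ℕ.* b ℕ.* (p ℕ.* p)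
              ring₂ = ℕ-Solver.solve-∀
      p∣a : p ∣ a
      p∣a with euclidsLemma a D′ prime p∣aD′
      ... | inj₁ p∣a  = p∣a
      ... | inj₂ p∣D′ = ⊥-elim (p∤D′ p∣D′)

  ≡0[modℚ]⇔p²∣numerator : ∀ {x Y D} → x ≃ Y / D → p ∣ D → ¬ p ℕ.* p ∣ D → x ≡0[modℚ p ] ⇔ p ℕ.* p ∣ ℤ.∣ Y ∣
  ≡0[modℚ]⇔p²∣numerator {x} {Y} {D} x≃Y/D = lowest-terms-≡0⇔ (coprime-↥↧ x)
    (trans (sym (ℤP.abs-* (↥ x) (+ D))) (trans (cong ℤ.∣_∣ (≃⇒↥*≡*↧ x≃Y/D)) (ℤP.abs-* Y (↧ x))))

  unit-multiple⇒p²∣⇔p²∣ : ∀ {c U V} → ¬ p ∣ c → + c * U ≡ - V [mod + p * + p ] →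
                           p ℕ.* p ∣ ℤ.∣ U ∣ ⇔ p ℕ.* p ∣ ℤ.∣ V ∣
  unit-multiple⇒p²∣⇔p²∣ {c} {U} {V} p∤c cU≡-V = mk⇔ to from
    where
    to : p ℕ.* p ∣ ℤ.∣ U ∣ → p ℕ.* p ∣ ℤ.∣ V ∣
    to p²∣U = Equivalence.to (≡0[modp²]⇔p²∣ p) (≡mod-trans (≡mod-reflexive (sym (ℤP.neg-involutive V))) (≡mod-neg -V≡0))
      where
      -V≡0 : - V ≡ + 0 [mod + p * + p ]
      -V≡0 = ≡mod-trans (≡mod-sym cU≡-V) (≡mod-trans (≡mod-* (≡mod-refl {a = + c}) (Equivalence.from (≡0[modp²]⇔p²∣ p) p²∣U))
                                                      (≡mod-reflexive (ℤP.*-zeroʳ (+ c))))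
    from : p ℕ.* p ∣ ℤ.∣ V ∣ → p ℕ.* p ∣ ℤ.∣ U ∣
    from p²∣V = prime²∣*⇒∣ p∤c (subst (p ℕ.* p ∣_) (ℤP.abs-* (+ c) U) (Equivalence.to (≡0[modp²]⇔p²∣ p) cU≡0))
      where
      cU≡0 : + c * U ≡ + 0 [mod + p * + p ]
      cU≡0 = ≡mod-trans cU≡-V (≡mod-neg (Equivalence.from (≡0[modp²]⇔p²∣ p) p²∣V))

GaussFactCriterion : (m p N k : ℕ) → Set
GaussFactCriterion m p N k =
  (gaussFact N p ℕ.^ (p ∸ 1) ≡ 1 [modℕ p ℕ.* p ])
  ⇔ (((+ 1) /ℚ m) ℚ.* (wilsonQuotient p ℚ.- harmonic k) ℚ.- sumFrom1 k (fermatQuotient p) ≡0[modℚ p ])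

module _ {h : ℕ} (prime : Prime (suc (suc h ℕ.+ suc h))) where

  private
    p′ = suc h ℕ.+ suc h
    p  = suc p′

  gaussFact-criterion : ∀ m′ n → suc m′ ℕ.* n ≡ p′ → GaussFactCriterion (suc m′) p (n ℕ.* p ℕ.+ n) n
  gaussFact-criterion m′ n mn≡p′ = ⇔.trans
    (unit-multiple⇒p²∣⇔p²∣ prime p∤m·n! (≡mod-trans (≡mod-reflexive casts) (key-congruence prime m n mn≡p′ (s≤s n≤p′))))
    (⇔.sym (≡0[modℚ]⇔p²∣numerator prime (rhs≃ p′ m′ n) (ℕD.∣n⇒∣m*n m (ℕD.m∣m*n (n !))) p²∤m·p·n!))
    where
    m = suc m′
    g = gaussFact (n ℕ.* p ℕ.+ n) p
    n≤p′ : n ℕ.≤ p′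
    n≤p′ = subst (n ℕ.≤_) mn≡p′ (ℕP.m≤n*m n m)
    m≤p′ : m ℕ.≤ p′
    m≤p′ = ℕD.∣⇒≤ (divides n (trans (sym mn≡p′) (ℕP.*-comm m n)))
    p∤m·n! : ¬ p ∣ m ℕ.* n !
    p∤m·n! = prime∤* prime (ℕD.>⇒∤ (s≤s m≤p′)) (prime∤! prime (s≤s n≤p′))
    p²∤m·p·n! : ¬ p ℕ.* p ∣ m ℕ.* (p ℕ.* n !)
    p²∤m·p·n! p²∣ = p∤m·n! (ℕD.*-cancelˡ-∣ p (subst (p ℕ.* p ∣_) (ring m p (n !)) p²∣))
      where ring : ∀ m p k → m ℕ.* (p ℕ.* k) ≡ p ℕ.* (m ℕ.* k)
            ring = ℕ-Solver.solve-∀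
    casts : + (m ℕ.* n !) * (+ (g ℕ.^ p′) - + 1) ≡ + m * + (n !) * ((+ g) ^ p′ - + 1)
    casts = cong₂ _*_ (ℤP.pos-* m (n !)) (cong (_- + 1) (pos-^ g p′))

parity : ∀ n → (∃[ h ] n ≡ h ℕ.+ h) ⊎ (∃[ h ] n ≡ suc (h ℕ.+ h))
parity zero = inj₁ (0 , refl)
parity (suc n) with parity n
... | inj₁ (h , n≡h+h)   = inj₂ (h , cong suc n≡h+h)
... | inj₂ (h , n≡1+h+h) = inj₁ (suc h , trans (cong suc n≡1+h+h) (cong suc (sym (ℕP.+-suc h h))))

odd-prime : ∀ {m p} → 2 ℕ.≤ m → Prime p → m ∣ p ∸ 1 → ∃[ h ] p ≡ suc (suc h ℕ.+ suc h)
odd-prime {p = zero} _ p-prime _ = ⊥-elim (¬prime[0] p-prime)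
odd-prime {m} {suc p′} 2≤m p-prime m∣p′ with parity p′
... | inj₁ (zero , refl)   = ⊥-elim (¬prime[1] p-prime)
... | inj₁ (suc h , refl)  = h , refl
... | inj₂ (h , refl) with prime⇒irreducible p-prime (divides (suc h) (ring h))
  where ring : ∀ h → suc (suc (h ℕ.+ h)) ≡ suc h ℕ.* 2
        ring = ℕ-Solver.solve-∀
...   | inj₁ ()
...   | inj₂ 2≡p = ⊥-elim (ℕP.<-irrefl (sym (ℕD.∣1⇒≡1 (subst (m ∣_) (cong ℕ.pred (sym 2≡p)) m∣p′))) 2≤m)

[p-1]/m≡n : ∀ {p′ m′ n} → p′ ≡ n ℕ.* suc m′ → (suc p′ ∸ 1) /ₙ suc m′ ≡ n
[p-1]/m≡n {m′ = m′} {n} refl = m*n/n≡m n (suc m′)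

[p²-1]/m≡np+n : ∀ {p′ m′ n} → p′ ≡ n ℕ.* suc m′ → (suc p′ ℕ.* suc p′ ∸ 1) /ₙ suc m′ ≡ n ℕ.* suc p′ ℕ.+ n
[p²-1]/m≡np+n {p′} {m′} {n} p′≡nm =
  trans (cong (_/ suc m′) p²-1≡[np+n]m) (m*n/n≡m (n ℕ.* suc p′ ℕ.+ n) (suc m′))
  where
  p²-1≡[np+n]m : p′ ℕ.+ p′ ℕ.* suc p′ ≡ (n ℕ.* suc p′ ℕ.+ n) ℕ.* suc m′
  p²-1≡[np+n]m = trans (ring₁ p′) (trans (cong (ℕ._* suc (suc p′)) p′≡nm) (ring₂ n m′ p′))
    where ring₁ : ∀ e → e ℕ.+ e ℕ.* suc e ≡ e ℕ.* suc (suc e)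
          ring₁ = ℕ-Solver.solve-∀
          ring₂ : ∀ n k e → n ℕ.* suc k ℕ.* suc (suc e) ≡ (n ℕ.* suc e ℕ.+ n) ℕ.* suc k
          ring₂ = ℕ-Solver.solve-∀

proposition4p1 : (m p : ℕ) → 2 ℕ.≤ m → Prime p → m ∣ (p ∸ 1) →
    ((gaussFact ((p ℕ.* p ∸ 1) /ₙ m) p) ℕ.^ (p ∸ 1) ≡ 1 [modℕ p ℕ.* p ])
    ⇔ ((((+ 1) /ℚ m) ℚ.* (wilsonQuotient p ℚ.- harmonic ((p ∸ 1) /ₙ m))
        ℚ.- sumFrom1 ((p ∸ 1) /ₙ m) (fermatQuotient p)) ≡0[modℚ p ])
proposition4p1 m p 2≤m p-prime m∣p-1 with odd-prime 2≤m p-prime m∣p-1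
proposition4p1 (suc m′) _ (s≤s _) p-prime (divides n p′≡nm) | h , refl =
  subst₂ (GaussFactCriterion (suc m′) _)
         (sym ([p²-1]/m≡np+n {m′ = m′} {n} p′≡nm)) (sym ([p-1]/m≡n {m′ = m′} {n} p′≡nm))
         (gaussFact-criterion p-prime m′ n (trans (ℕP.*-comm (suc m′) n) (sym p′≡nm)))
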